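{- Let $r$ be a positive integer and let $G$ be an $r$-regular graph of order $n$ and girth at least $5$. Then $$Z(G)\leq \left(\prod_{i=1}^r\left(1-\frac{1}{ri+1}\right)\right)n.$$ Moreover, $\prod_{i=1}^r\left(1-\frac{1}{ri+1}\right)=1-\frac{H_r}{r}+O\!\left(\left(\frac{H_r}{r}\right)^2\right)$, i.e. there is an absolute constant $C$ such that for all $r\geq 1$, $\left|\prod_{i=1}^r\left(1-\frac{1}{ri+1}\right)-\left(1-\frac{H_r}{r}\right)\right|\leq C\left(\frac{H_r}{r}\right)^2$; in particular $Z(G)\leq \left(1-\frac{H_r}{r}\right)n+O\!\left(\left(\frac{H_r}{r}\right)^2\right)n$.
   Context: All graphs are finite, simple and undirected; the girth is the length of a shortest cycle. $H_r=\sum_{i=1}^r\frac1i$ is the $r$-th harmonic number. For a set $Z\subseteq V(G)$, let $\mathcal{F}(Z)$ be the set obtained from $Z$ by repeatedly adding a vertex $u$ outside the current set whenever $u$ is the unique neighbor outside the current set of some vertex in the current set, as long as possible. $Z$ is a zero forcing set of $G$ if $\mathcal{F}(Z)=V(G)$. The zero forcing number $Z(G)$ is the minimum cardinality of a zero forcing set of $G$. -}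

module Defs where

open import Data.Nat as ℕ using (ℕ; zero; suc; _≤_)
open import Data.Integer using (+_)
open import Data.Rational as ℚ using (ℚ; 0ℚ; 1ℚ; _/_; _+_; _*_; _-_)
open import Data.Fin using (Fin)
open import Data.Fin.Subset as S using (Subset; _∈_; _∉_; _∪_; ⁅_⁆; ⊤)
open import Data.List using (List; []; _∷_; _++_; [_]; length)
open import Data.List.Relation.Unary.Unique.Propositional using (Unique)
open import Data.List.Relation.Binary.Pointwise using ()
open import Data.List.Relation.Unary.Linked using (Linked)
open import Data.Product using (Σ; _×_)
open import Relation.Binary.PropositionalEquality using (_≡_)
open import Relation.Nullary using (¬_)

record Graph (n : ℕ) : Set where
  field
    N         : Fin n → Subset n
    symmetric : ∀ u v → v ∈ N u → u ∈ N v
    loopless  : ∀ v → v ∉ N v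

module _ {n : ℕ} (G : Graph n) where
  open Graph G

  Adj : Fin n → Fin n → Set
  Adj u v = v ∈ N u

  degree : Fin n → ℕ
  degree v = S.∣ N v ∣

  Regular : ℕ → Set
  Regular r = ∀ v → degree v ≡ r

  record Cycle : Set where
    field
      start  : Fin n
      rest   : List (Fin n)
      long   : 3 ≤ length (start ∷ rest)
      unique : Unique (start ∷ rest)
      closed : Linked Adj (start ∷ rest ++ [ start ])

  cycleLength : Cycle → ℕ
  cycleLength c = length (Cycle.start c ∷ Cycle.rest c)

  GirthAtLeast : ℕ → Set
  GirthAtLeast g = (c : Cycle) → g ≤ cycleLength c

  data Forcing : Subset n → Subset n → Set where
    done : ∀ {S} → Forcing S S
    step : ∀ {S T} (w u : Fin n) → w ∈ S → u ∉ S → Adj w u →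
           (∀ x → Adj w x → x ∉ S → x ≡ u) →
           Forcing (S ∪ ⁅ u ⁆) T → Forcing S T

  -- Z is zero forcing: the forcing process can reach all of V(G)
  -- (the closure F(Z) is order independent, so this is F(Z) = V(G)).
  IsZeroForcingSet : Subset n → Set
  IsZeroForcingSet Z = Forcing Z ⊤

  IsZeroForcingNumber : ℕ → Set
  IsZeroForcingNumber k =
    Σ (Subset n) (λ Z → IsZeroForcingSet Z × S.∣ Z ∣ ≡ k)
    × (∀ Z → IsZeroForcingSet Z → k ≤ S.∣ Z ∣)

H : ℕ → ℚ
H zero    = 0ℚ
H (suc i) = H i + (+ 1 / suc i)

prodUpTo : ℕ → ℕ → ℚ
prodUpTo r zero    = 1ℚ
prodUpTo r (suc i) = prodUpTo r i * (1ℚ - (+ 1 / suc (r ℕ.* suc i)))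

P : ℕ → ℚ
P r = prodUpTo r r

HoverR : (r : ℕ) → .{{_ : ℕ.NonZero r}} → ℚ
HoverR r = H r * (+ 1 / r)

toℚ : ℕ → ℚ
toℚ n = + n / 1

-- Label the vertices independently and uniformly from the grid {0, 1/M, …, (M−1)/M}, order
-- them by label, and call v unforceable unless some neighbour w has N[w] ∖ {v} entirely before v.
-- The unforceable vertices form a zero forcing set: for a missing vertex v with such a witness w,
-- either w forces v or some missing vertex of N[w] ∖ {v} comes earlier, so the process never stops
-- short of V(G). Girth at least five makes the r sets N[w] ∖ {v} (w ∈ N(v)) pairwise disjoint and
-- free of v, so given the label x of v, the events that N[w] ∖ {v} lies entirely below x are
-- independent, each of probability xʳ, and v is unforceable only if none of them occurs. The
-- expected number of unforceable vertices is therefore at most n times a Riemann sum of (1 − xʳ)ʳ,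
-- which exceeds ∫₀¹ (1 − xʳ)ʳ dx = P r by at most 2ʳ/M; let M grow. Comparing the factors
-- 1 − 1/(ri + 1) of P r with 1/(ri) gives 1 − Hᵣ/r ≤ P r ≤ 1 − Hᵣ/r + 2 (Hᵣ/r)².

module Submission where

open import Algebra.Bundles using (CommutativeRing)
open import Data.Bool using (Bool; true; false; not; T)
open import Data.Empty using (⊥; ⊥-elim)
open import Data.Fin as F using (Fin; zero; suc; toℕ)
import Data.Fin.Properties as FP
open import Data.Fin.Subset as S using (Subset; _∈_; _∉_; _⊆_; _∪_; ⁅_⁆; ∁; inside; outside)
import Data.Fin.Subset.Properties as SP
open import Data.Integer as ℤ using (ℤ; +_; -[1+_])
import Data.Integer.Properties as ℤP
import Data.List as L
import Data.List.Relation.Unary.All as All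
import Data.List.Relation.Unary.AllPairs as AP
import Data.List.Relation.Unary.Linked as Lk
open import Data.Nat as ℕ using (ℕ; zero; suc; z≤n; s≤s)
import Data.Nat.Induction as ℕI
import Data.Nat.Properties as ℕP
open import Data.Nat.Tactic.RingSolver using (solve-∀)
open import Data.Product using (Σ; ∃-syntax; _×_; _,_; proj₁; proj₂)
open import Data.Rational as ℚ using (ℚ; mkℚ; 0ℚ; 1ℚ; _+_; _*_; _-_; -_; _≤_; _<_; _/_; ∣_∣)
import Data.Rational.Properties as ℚP
open import Data.Rational.Solver using (module +-*-Solver)
open import Data.Rational.Unnormalised as ℚᵘ using (mkℚᵘ; *≡*; *≤*; *<*)
import Data.Rational.Unnormalised.Properties as ℚᵘP
open import Data.Sum using (_⊎_; inj₁; inj₂)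
open import Data.Unit using (tt)
open import Data.Vec as V using (lookup; tabulate)
open import Data.Vec.Functional using (_∷_)
import Data.Vec.Properties as VP
open import Function using (_∘_)
open import Induction.WellFounded using (Acc; acc)
open import Relation.Binary.PropositionalEquality
open import Relation.Nullary using (¬_; Dec; yes; no; does; ¬?; _×-dec_; _→-dec_)
open import Relation.Nullary.Decidable using (decidable-stable)

open import Defs

open CommutativeRing ℚP.+-*-commutativeRing using (semiring; commutativeSemiring)
open import Algebra.Properties.Semiring.Sum semiring using (sum; sum-cong-≗; ∑-comm; ∑-distrib-+; *-distribˡ-sum; sum-init-last)
open import Algebra.Properties.Semiring.Exp semiring using (_^_; ^-homo-*)
open import Algebra.Properties.CommutativeSemiring.Exp commutativeSemiring using (^-distrib-*)
open +-*-Solver using (solve; _:+_; _:*_; _:-_; :-_; _:=_; con)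

1/suc : ℕ → ℚ
1/suc d = + 1 / suc d

toℚᵘ-/suc : ∀ (i : ℤ) d → ℚ.toℚᵘ (i / suc d) ℚᵘ.≃ mkℚᵘ i d
toℚᵘ-/suc i d = ℚP.toℚᵘ-fromℚᵘ (mkℚᵘ i d)

toℚᵘ-toℚ : ∀ n → ℚ.toℚᵘ (toℚ n) ℚᵘ.≃ mkℚᵘ (+ n) 0
toℚᵘ-toℚ n = toℚᵘ-/suc (+ n) 0

toℚ-+ : ∀ m n → toℚ (m ℕ.+ n) ≡ toℚ m + toℚ n
toℚ-+ m n = ℚP.toℚᵘ-injective (begin
  ℚ.toℚᵘ (toℚ (m ℕ.+ n))               ≈⟨ toℚᵘ-toℚ (m ℕ.+ n) ⟩
  mkℚᵘ (+ (m ℕ.+ n)) 0                 ≈⟨ *≡* (cong (ℤ._* + 1) numerators) ⟩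
  mkℚᵘ (+ m) 0 ℚᵘ.+ mkℚᵘ (+ n) 0       ≈⟨ ℚᵘP.+-cong (toℚᵘ-toℚ m) (toℚᵘ-toℚ n) ⟨
  ℚ.toℚᵘ (toℚ m) ℚᵘ.+ ℚ.toℚᵘ (toℚ n)   ≈⟨ ℚP.toℚᵘ-homo-+ (toℚ m) (toℚ n) ⟨
  ℚ.toℚᵘ (toℚ m + toℚ n)               ∎)
  where
  open ℚᵘP.≃-Reasoning
  numerators : + (m ℕ.+ n) ≡ + m ℤ.* + 1 ℤ.+ + n ℤ.* + 1
  numerators = cong₂ ℤ._+_ (sym (ℤP.*-identityʳ (+ m))) (sym (ℤP.*-identityʳ (+ n)))

toℚ-* : ∀ m n → toℚ (m ℕ.* n) ≡ toℚ m * toℚ n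
toℚ-* m n = ℚP.toℚᵘ-injective (begin
  ℚ.toℚᵘ (toℚ (m ℕ.* n))               ≈⟨ toℚᵘ-toℚ (m ℕ.* n) ⟩
  mkℚᵘ (+ (m ℕ.* n)) 0                 ≈⟨ *≡* (cong (ℤ._* + 1) (ℤP.pos-* m n)) ⟩
  mkℚᵘ (+ m) 0 ℚᵘ.* mkℚᵘ (+ n) 0       ≈⟨ ℚᵘP.*-cong (toℚᵘ-toℚ m) (toℚᵘ-toℚ n) ⟨
  ℚ.toℚᵘ (toℚ m) ℚᵘ.* ℚ.toℚᵘ (toℚ n)   ≈⟨ ℚP.toℚᵘ-homo-* (toℚ m) (toℚ n) ⟨
  ℚ.toℚᵘ (toℚ m * toℚ n)               ∎)
  where open ℚᵘP.≃-Reasoning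

/suc≡toℚ*1/suc : ∀ a d → + a / suc d ≡ toℚ a * 1/suc d
/suc≡toℚ*1/suc a d = ℚP.toℚᵘ-injective (begin
  ℚ.toℚᵘ (+ a / suc d)                   ≈⟨ toℚᵘ-/suc (+ a) d ⟩
  mkℚᵘ (+ a) d                           ≈⟨ *≡* denominators ⟩
  mkℚᵘ (+ a) 0 ℚᵘ.* mkℚᵘ (+ 1) d         ≈⟨ ℚᵘP.*-cong (toℚᵘ-toℚ a) (toℚᵘ-/suc (+ 1) d) ⟨
  ℚ.toℚᵘ (toℚ a) ℚᵘ.* ℚ.toℚᵘ (1/suc d)   ≈⟨ ℚP.toℚᵘ-homo-* (toℚ a) (1/suc d) ⟨
  ℚ.toℚᵘ (toℚ a * 1/suc d)               ∎)
  where
  open ℚᵘP.≃-Reasoning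
  denominators : + a ℤ.* + suc (d ℕ.+ 0) ≡ + a ℤ.* + 1 ℤ.* + suc d
  denominators = cong₂ (λ i k → i ℤ.* + suc k) (sym (ℤP.*-identityʳ (+ a))) (ℕP.+-identityʳ d)

1/suc-inverse : ∀ d → 1/suc d * toℚ (suc d) ≡ 1ℚ
1/suc-inverse d = ℚP.toℚᵘ-injective (begin
  ℚ.toℚᵘ (1/suc d * toℚ (suc d))             ≈⟨ ℚP.toℚᵘ-homo-* (1/suc d) (toℚ (suc d)) ⟩
  ℚ.toℚᵘ (1/suc d) ℚᵘ.* ℚ.toℚᵘ (toℚ (suc d)) ≈⟨ ℚᵘP.*-cong (toℚᵘ-/suc (+ 1) d) (toℚᵘ-toℚ (suc d)) ⟩
  mkℚᵘ (+ 1) d ℚᵘ.* mkℚᵘ (+ suc d) 0         ≈⟨ *≡* cross ⟩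
  ℚᵘ.1ℚᵘ                                     ∎)
  where
  open ℚᵘP.≃-Reasoning
  cross : + 1 ℤ.* + suc d ℤ.* + 1 ≡ + 1 ℤ.* + suc (d ℕ.* 1)
  cross = trans (ℤP.*-identityʳ _) (cong (λ k → + 1 ℤ.* + suc k) (sym (ℕP.*-identityʳ d)))

1/suc-* : ∀ a b → 1/suc a * 1/suc b ≡ 1/suc (b ℕ.+ a ℕ.* suc b)
1/suc-* a b = ℚP.toℚᵘ-injective (begin
  ℚ.toℚᵘ (1/suc a * 1/suc b)                 ≈⟨ ℚP.toℚᵘ-homo-* (1/suc a) (1/suc b) ⟩
  ℚ.toℚᵘ (1/suc a) ℚᵘ.* ℚ.toℚᵘ (1/suc b)     ≈⟨ ℚᵘP.*-cong (toℚᵘ-/suc (+ 1) a) (toℚᵘ-/suc (+ 1) b) ⟩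
  mkℚᵘ (+ 1) (b ℕ.+ a ℕ.* suc b)             ≈⟨ toℚᵘ-/suc (+ 1) _ ⟨
  ℚ.toℚᵘ (1/suc (b ℕ.+ a ℕ.* suc b))         ∎)
  where open ℚᵘP.≃-Reasoning

toℚ-mono-≤ : ∀ {m n} → m ℕ.≤ n → toℚ m ≤ toℚ n
toℚ-mono-≤ {m} {n} m≤n = ℚP.toℚᵘ-cancel-≤
  (ℚᵘP.≤-respˡ-≃ (ℚᵘP.≃-sym (toℚᵘ-toℚ m)) (ℚᵘP.≤-respʳ-≃ (ℚᵘP.≃-sym (toℚᵘ-toℚ n))
    (*≤* (ℤP.*-monoʳ-≤-nonNeg (+ 1) (ℤ.+≤+ m≤n)))))

toℚ-nonNeg : ∀ n → 0ℚ ≤ toℚ n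
toℚ-nonNeg n = toℚ-mono-≤ {0} {n} z≤n

1/suc-antimono-< : ∀ {m n} → m ℕ.< n → 1/suc n < 1/suc m
1/suc-antimono-< {m} {n} m<n = ℚP.toℚᵘ-cancel-<
  (ℚᵘP.<-respˡ-≃ (ℚᵘP.≃-sym (toℚᵘ-/suc (+ 1) n)) (ℚᵘP.<-respʳ-≃ (ℚᵘP.≃-sym (toℚᵘ-/suc (+ 1) m))
    (*<* (ℤP.*-monoˡ-<-pos (+ 1) (ℤ.+<+ (s≤s m<n))))))

1/suc-antimono-≤ : ∀ {m n} → m ℕ.≤ n → 1/suc n ≤ 1/suc m
1/suc-antimono-≤ {m} {n} m≤n with ℕP.m≤n⇒m<n∨m≡n m≤n
... | inj₁ m<n  = ℚP.<⇒≤ (1/suc-antimono-< m<n)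
... | inj₂ refl = ℚP.≤-refl

1/suc-nonNeg : ∀ d → 0ℚ ≤ 1/suc d
1/suc-nonNeg d = ℚP.toℚᵘ-cancel-≤ (ℚᵘP.≤-respʳ-≃ (ℚᵘP.≃-sym (toℚᵘ-/suc (+ 1) d)) (*≤* (ℤ.+≤+ z≤n)))

1/suc≤1 : ∀ d → 1/suc d ≤ 1ℚ
1/suc≤1 d = 1/suc-antimono-≤ {0} {d} z≤n

0≤1 : 0ℚ ≤ 1ℚ
0≤1 = ℚP.nonNegative⁻¹ 1ℚ

*-monoʳ-≤-0≤ : ∀ {r} → 0ℚ ≤ r → ∀ {p q} → p ≤ q → p * r ≤ q * r
*-monoʳ-≤-0≤ {r} 0≤r = ℚP.*-monoʳ-≤-nonNeg r {{ℚ.nonNegative 0≤r}}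

*-monoˡ-≤-0≤ : ∀ {r} → 0ℚ ≤ r → ∀ {p q} → p ≤ q → r * p ≤ r * q
*-monoˡ-≤-0≤ {r} 0≤r = ℚP.*-monoˡ-≤-nonNeg r {{ℚ.nonNegative 0≤r}}

0≤*0≤ : ∀ {p q} → 0ℚ ≤ p → 0ℚ ≤ q → 0ℚ ≤ p * q
0≤*0≤ {p} {q} 0≤p 0≤q = subst (_≤ p * q) (ℚP.*-zeroˡ q) (*-monoʳ-≤-0≤ 0≤q 0≤p)

p≤q⇒0≤q-p : ∀ {p q} → p ≤ q → 0ℚ ≤ q - p
p≤q⇒0≤q-p {p} {q} p≤q = subst (_≤ q - p) (ℚP.+-inverseʳ p) (ℚP.+-monoˡ-≤ (- p) p≤q)

sub-mono-≤ : ∀ {p q r s} → p ≤ q → r ≤ s → p - s ≤ q - r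
sub-mono-≤ p≤q r≤s = ℚP.+-mono-≤ p≤q (ℚP.neg-antimono-≤ r≤s)

p≤p+q : ∀ {p q} → 0ℚ ≤ q → p ≤ p + q
p≤p+q {p} {q} 0≤q = subst (_≤ p + q) (ℚP.+-identityʳ p) (ℚP.+-monoʳ-≤ p 0≤q)

InUnitInterval : ℚ → Set
InUnitInterval p = 0ℚ ≤ p × p ≤ 1ℚ

*-InUnitInterval : ∀ {p q} → InUnitInterval p → InUnitInterval q → InUnitInterval (p * q)
*-InUnitInterval {p} {q} (0≤p , p≤1) (0≤q , q≤1) = 0≤*0≤ 0≤p 0≤q ,
  ℚP.≤-trans (*-monoˡ-≤-0≤ 0≤p q≤1) (subst (_≤ 1ℚ) (sym (ℚP.*-identityʳ p)) p≤1)

1-InUnitInterval : ∀ {p} → InUnitInterval p → InUnitInterval (1ℚ - p)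
1-InUnitInterval {p} (0≤p , p≤1) = p≤q⇒0≤q-p p≤1 , subst (1ℚ - p ≤_) (ℚP.+-identityʳ 1ℚ) (sub-mono-≤ ℚP.≤-refl 0≤p)

sum-mono-≤ : ∀ {k} {f g : Fin k → ℚ} → (∀ i → f i ≤ g i) → sum f ≤ sum g
sum-mono-≤ {zero}  f≤g = ℚP.≤-refl
sum-mono-≤ {suc k} f≤g = ℚP.+-mono-≤ (f≤g zero) (sum-mono-≤ (f≤g ∘ suc))

sum-const : ∀ k c → sum {k} (λ _ → c) ≡ toℚ k * c
sum-const zero    c = sym (ℚP.*-zeroˡ c)
sum-const (suc k) c = begin
  c + sum {k} (λ _ → c)  ≡⟨ cong (_+_ c) (sum-const k c) ⟩
  c + toℚ k * c          ≡⟨ distrib c (toℚ k) ⟩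
  (1ℚ + toℚ k) * c       ≡⟨ cong (_* c) (toℚ-+ 1 k) ⟨
  toℚ (suc k) * c        ∎
  where
  open ≡-Reasoning
  distrib : ∀ c x → c + x * c ≡ (1ℚ + x) * c
  distrib = solve 2 (λ c x → c :+ x :* c := (con 1ℚ :+ x) :* c) refl

sum-scale : ∀ {k} c (f : Fin k → ℚ) → sum (λ i → c * f i) ≡ c * sum f
sum-scale c f = sym (*-distribˡ-sum c f)

χ : Bool → ℚ
χ true  = 1ℚ
χ false = 0ℚ

χ-InUnitInterval : ∀ b → InUnitInterval (χ b)
χ-InUnitInterval true  = 0≤1 , ℚP.≤-refl
χ-InUnitInterval false = ℚP.≤-refl , 0≤1

toℚ-∣p∣ : ∀ {n} (p : Subset n) → toℚ S.∣ p ∣ ≡ sum (λ x → χ (lookup p x))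
toℚ-∣p∣ V.[]            = refl
toℚ-∣p∣ (inside V.∷ p)  = trans (toℚ-+ 1 S.∣ p ∣) (cong (_+_ 1ℚ) (toℚ-∣p∣ p))
toℚ-∣p∣ (outside V.∷ p) = trans (toℚ-∣p∣ p) (sym (ℚP.+-identityˡ _))

sum-χ-<ᵇ : ∀ k t → t ℕ.≤ k → sum {k} (λ a → χ (toℕ a ℕ.<ᵇ t)) ≡ toℚ t
sum-χ-<ᵇ zero    zero    _         = refl
sum-χ-<ᵇ (suc k) zero    _         = trans (ℚP.+-identityˡ _) (sum-χ-<ᵇ k zero z≤n)
sum-χ-<ᵇ (suc k) (suc t) (s≤s t≤k) = trans (cong (_+_ 1ℚ) (sum-χ-<ᵇ k t t≤k)) (sym (toℚ-+ 1 t))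

toℚ-^ : ∀ m a → toℚ (m ℕ.^ a) ≡ toℚ m ^ a
toℚ-^ m zero    = refl
toℚ-^ m (suc a) = trans (toℚ-* m (m ℕ.^ a)) (cong (toℚ m *_) (toℚ-^ m a))

∏∈ : ∀ {n} → Subset n → (Fin n → ℚ) → ℚ
∏∈ V.[]            f = 1ℚ
∏∈ (inside V.∷ A)  f = f zero * ∏∈ A (f ∘ suc)
∏∈ (outside V.∷ A) f = ∏∈ A (f ∘ suc)

∏∈-cong : ∀ {n} (A : Subset n) {f g} → (∀ {x} → x ∈ A → f x ≡ g x) → ∏∈ A f ≡ ∏∈ A g
∏∈-cong V.[]            f≗g = refl
∏∈-cong (inside V.∷ A)  f≗g = cong₂ _*_ (f≗g V.here) (∏∈-cong A (f≗g ∘ V.there))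
∏∈-cong (outside V.∷ A) f≗g = ∏∈-cong A (f≗g ∘ V.there)

∏∈-const : ∀ {n} (A : Subset n) c → ∏∈ A (λ _ → c) ≡ c ^ S.∣ A ∣
∏∈-const V.[]            c = refl
∏∈-const (inside V.∷ A)  c = cong (c *_) (∏∈-const A c)
∏∈-const (outside V.∷ A) c = ∏∈-const A c

∏∈-≡1 : ∀ {n} (A : Subset n) {f} → (∀ {x} → x ∈ A → f x ≡ 1ℚ) → ∏∈ A f ≡ 1ℚ
∏∈-≡1 V.[]            f≡1 = refl
∏∈-≡1 (inside V.∷ A)  f≡1 = cong₂ _*_ (f≡1 V.here) (∏∈-≡1 A (f≡1 ∘ V.there))
∏∈-≡1 (outside V.∷ A) f≡1 = ∏∈-≡1 A (f≡1 ∘ V.there)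

∏∈-InUnitInterval : ∀ {n} (A : Subset n) {f} → (∀ x → InUnitInterval (f x)) → InUnitInterval (∏∈ A f)
∏∈-InUnitInterval V.[]            f∈I = 0≤1 , ℚP.≤-refl
∏∈-InUnitInterval (inside V.∷ A)  f∈I = *-InUnitInterval (f∈I zero) (∏∈-InUnitInterval A (f∈I ∘ suc))
∏∈-InUnitInterval (outside V.∷ A) f∈I = ∏∈-InUnitInterval A (f∈I ∘ suc)

∏∈-χ : ∀ {n} (A : Subset n) (b : Fin n → Bool) → ∏∈ A (χ ∘ b) ≡ 0ℚ ⊎ (∀ {x} → x ∈ A → b x ≡ true)
∏∈-χ V.[] b = inj₂ λ ()
∏∈-χ (inside V.∷ A) b with b zero in b₀ | ∏∈-χ A (b ∘ suc)
... | false | _      = inj₁ (ℚP.*-zeroˡ (∏∈ A (χ ∘ b ∘ suc)))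
... | true  | inj₁ z = inj₁ (trans (ℚP.*-identityˡ _) z)
... | true  | inj₂ t = inj₂ λ { V.here → b₀ ; (V.there x∈A) → t x∈A }
∏∈-χ (outside V.∷ A) b with ∏∈-χ A (b ∘ suc)
... | inj₁ z = inj₁ z
... | inj₂ t = inj₂ λ { (V.there x∈A) → t x∈A }

∣p∪⁅x⁆∣≡1+∣p∣ : ∀ {n} {x : Fin n} (p : Subset n) → x ∉ p → S.∣ p ∪ ⁅ x ⁆ ∣ ≡ suc S.∣ p ∣
∣p∪⁅x⁆∣≡1+∣p∣ {x = zero}  (outside V.∷ p) _   = cong (suc ∘ S.∣_∣) (SP.∪-identityʳ p)
∣p∪⁅x⁆∣≡1+∣p∣ {x = zero}  (inside V.∷ p)  x∉p = ⊥-elim (x∉p V.here)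
∣p∪⁅x⁆∣≡1+∣p∣ {x = suc x} (outside V.∷ p) x∉p = ∣p∪⁅x⁆∣≡1+∣p∣ p (x∉p ∘ V.there)
∣p∪⁅x⁆∣≡1+∣p∣ {x = suc x} (inside V.∷ p)  x∉p = cong suc (∣p∪⁅x⁆∣≡1+∣p∣ p (x∉p ∘ V.there))

x∈p⇒1+∣p-x∣≡∣p∣ : ∀ {n} {x : Fin n} (p : Subset n) → x ∈ p → suc S.∣ p S.- x ∣ ≡ S.∣ p ∣
x∈p⇒1+∣p-x∣≡∣p∣ {x = zero}  (inside V.∷ p)  _         = cong (suc ∘ S.∣_∣) (SP.p─⊥≡p p)
x∈p⇒1+∣p-x∣≡∣p∣ {x = suc x} (outside V.∷ p) (V.there x∈p) = x∈p⇒1+∣p-x∣≡∣p∣ p x∈p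
x∈p⇒1+∣p-x∣≡∣p∣ {x = suc x} (inside V.∷ p)  (V.there x∈p) = cong suc (x∈p⇒1+∣p-x∣≡∣p∣ p x∈p)

x∈p-y⇒x≢y : ∀ {n} {x y : Fin n} (p : Subset n) → x ∈ p S.- y → x ≢ y
x∈p-y⇒x≢y {x = zero}  {zero}  (inside V.∷ p)  () refl
x∈p-y⇒x≢y {x = zero}  {zero}  (outside V.∷ p) () refl
x∈p-y⇒x≢y {x = suc x} {suc y} (b V.∷ p) (V.there x∈p-y) refl = x∈p-y⇒x≢y p x∈p-y refl

Disjoint : ∀ {n} → Subset n → Subset n → Set
Disjoint A B = ∀ {i} → i ∈ A → i ∉ B

PairwiseDisjointOn : ∀ {k n} → Subset k → (Fin k → Subset n) → Set
PairwiseDisjointOn I B = ∀ {i j} → i ∈ I → j ∈ I → i ≢ j → Disjoint (B i) (B j)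

PairwiseDisjointOn-tail : ∀ {k n b} {I : Subset k} {B : Fin (suc k) → Subset n} →
                          PairwiseDisjointOn (b V.∷ I) B → PairwiseDisjointOn I (B ∘ suc)
PairwiseDisjointOn-tail disjoint i∈I j∈I i≢j = disjoint (V.there i∈I) (V.there j∈I) (i≢j ∘ FP.suc-injective)

∃-minimum : ∀ {k} (φ : Fin (suc k) → ℚ) → ∃[ a ] (∀ b → φ a ≤ φ b)
∃-minimum {zero}  φ = zero , λ { zero → ℚP.≤-refl }
∃-minimum {suc k} φ with ∃-minimum (φ ∘ suc)
... | a , a-min with ℚP.≤-total (φ zero) (φ (suc a))
...   | inj₁ φ₀≤ = zero , λ { zero → ℚP.≤-refl ; (suc b) → ℚP.≤-trans φ₀≤ (a-min b) }
...   | inj₂ ≤φ₀ = suc a , λ { zero → ≤φ₀ ; (suc b) → a-min b }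

-- Uniformly random labellings

module Uniform (M′ : ℕ) where

  M : ℕ
  M = suc M′

  Labelling : ℕ → Set
  Labelling n = Fin n → Fin M

  gridPoint : Fin M → ℚ
  gridPoint m = 1/suc M′ * toℚ (toℕ m)

  mean : (Fin M → ℚ) → ℚ
  mean φ = 1/suc M′ * sum φ

  mean-cong : ∀ {φ ψ} → (∀ a → φ a ≡ ψ a) → mean φ ≡ mean ψ
  mean-cong φ≗ψ = cong (_*_ (1/suc M′)) (sum-cong-≗ φ≗ψ)

  mean-const : ∀ c → mean (λ _ → c) ≡ c
  mean-const c = begin
    1/suc M′ * sum {M} (λ _ → c)  ≡⟨ cong (_*_ (1/suc M′)) (sum-const M c) ⟩
    1/suc M′ * (toℚ M * c)        ≡⟨ ℚP.*-assoc (1/suc M′) (toℚ M) c ⟨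
    1/suc M′ * toℚ M * c          ≡⟨ cong (_* c) (1/suc-inverse M′) ⟩
    1ℚ * c                        ≡⟨ ℚP.*-identityˡ c ⟩
    c                             ∎
    where open ≡-Reasoning

  mean-scale : ∀ c φ → mean (λ a → c * φ a) ≡ c * mean φ
  mean-scale c φ = trans (cong (_*_ (1/suc M′)) (sum-scale c φ)) (swap (1/suc M′) c (sum φ))
    where
    swap : ∀ x y z → x * (y * z) ≡ y * (x * z)
    swap = solve 3 (λ x y z → x :* (y :* z) := y :* (x :* z)) refl

  mean-+ : ∀ φ ψ → mean (λ a → φ a + ψ a) ≡ mean φ + mean ψ
  mean-+ φ ψ = trans (cong (_*_ (1/suc M′)) (∑-distrib-+ φ ψ)) (ℚP.*-distribˡ-+ (1/suc M′) (sum φ) (sum ψ))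

  mean-sub : ∀ φ ψ → mean (λ a → φ a - ψ a) ≡ mean φ - mean ψ
  mean-sub φ ψ = begin
    mean (λ a → φ a - ψ a)            ≡⟨ mean-cong (λ a → sub-as-scale (φ a) (ψ a)) ⟩
    mean (λ a → φ a + - 1ℚ * ψ a)     ≡⟨ mean-+ φ (λ a → - 1ℚ * ψ a) ⟩
    mean φ + mean (λ a → - 1ℚ * ψ a)  ≡⟨ cong (_+_ (mean φ)) (mean-scale (- 1ℚ) ψ) ⟩
    mean φ + - 1ℚ * mean ψ            ≡⟨ sub-as-scale (mean φ) (mean ψ) ⟨
    mean φ - mean ψ                   ∎
    where
    open ≡-Reasoning
    sub-as-scale : ∀ x y → x - y ≡ x + - 1ℚ * y
    sub-as-scale = solve 2 (λ x y → x :- y := x :+ con (- 1ℚ) :* y) refl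

  mean-mono-≤ : ∀ {φ ψ} → (∀ a → φ a ≤ ψ a) → mean φ ≤ mean ψ
  mean-mono-≤ φ≤ψ = *-monoˡ-≤-0≤ (1/suc-nonNeg M′) (sum-mono-≤ φ≤ψ)

  mean-comm : ∀ (φ : Fin M → Fin M → ℚ) → mean (λ a → mean (φ a)) ≡ mean (λ b → mean (λ a → φ a b))
  mean-comm φ = begin
    mean (λ a → mean (φ a))                         ≡⟨ cong (_*_ (1/suc M′)) (sum-scale (1/suc M′) (λ a → sum (φ a))) ⟩
    1/suc M′ * (1/suc M′ * sum (λ a → sum (φ a)))   ≡⟨ cong (λ s → 1/suc M′ * (1/suc M′ * s)) (∑-comm φ) ⟩
    1/suc M′ * (1/suc M′ * sum (λ b → sum (λ a → φ a b)))  ≡⟨ cong (_*_ (1/suc M′)) (sum-scale (1/suc M′) (λ b → sum (λ a → φ a b))) ⟨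
    mean (λ b → mean (λ a → φ a b))                 ∎
    where open ≡-Reasoning

  ∃-≤-mean : ∀ φ → ∃[ a ] φ a ≤ mean φ
  ∃-≤-mean φ with ∃-minimum φ
  ... | a , a-min = a , subst (_≤ mean φ) (mean-const (φ a)) (mean-mono-≤ a-min)

  no-labels : Labelling 0
  no-labels ()

  𝔼 : ∀ n → (Labelling n → ℚ) → ℚ
  𝔼 zero    f = f no-labels
  𝔼 (suc n) f = mean (λ a → 𝔼 n (λ t → f (a ∷ t)))

  𝔼-cong : ∀ n {f g} → (∀ y → f y ≡ g y) → 𝔼 n f ≡ 𝔼 n g
  𝔼-cong zero    f≗g = f≗g _
  𝔼-cong (suc n) f≗g = mean-cong (λ a → 𝔼-cong n (λ t → f≗g (a ∷ t)))

  𝔼-const : ∀ n c → 𝔼 n (λ _ → c) ≡ c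
  𝔼-const zero    c = refl
  𝔼-const (suc n) c = trans (mean-cong (λ _ → 𝔼-const n c)) (mean-const c)

  𝔼-scale : ∀ n c f → 𝔼 n (λ y → c * f y) ≡ c * 𝔼 n f
  𝔼-scale zero    c f = refl
  𝔼-scale (suc n) c f = trans (mean-cong (λ a → 𝔼-scale n c (λ t → f (a ∷ t)))) (mean-scale c (λ a → 𝔼 n (λ t → f (a ∷ t))))

  𝔼-+ : ∀ n f g → 𝔼 n (λ y → f y + g y) ≡ 𝔼 n f + 𝔼 n g
  𝔼-+ zero    f g = refl
  𝔼-+ (suc n) f g = trans (mean-cong (λ a → 𝔼-+ n (λ t → f (a ∷ t)) (λ t → g (a ∷ t))))
                          (mean-+ (λ a → 𝔼 n (λ t → f (a ∷ t))) (λ a → 𝔼 n (λ t → g (a ∷ t))))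

  𝔼-1- : ∀ n f → 𝔼 n (λ y → 1ℚ - f y) ≡ 1ℚ - 𝔼 n f
  𝔼-1- n f = begin
    𝔼 n (λ y → 1ℚ - f y)            ≡⟨ 𝔼-cong n (λ y → neg-as-scale (f y)) ⟩
    𝔼 n (λ y → 1ℚ + - 1ℚ * f y)     ≡⟨ 𝔼-+ n (λ _ → 1ℚ) (λ y → - 1ℚ * f y) ⟩
    𝔼 n (λ _ → 1ℚ) + 𝔼 n (λ y → - 1ℚ * f y)  ≡⟨ cong₂ _+_ (𝔼-const n 1ℚ) (𝔼-scale n (- 1ℚ) f) ⟩
    1ℚ + - 1ℚ * 𝔼 n f               ≡⟨ neg-as-scale (𝔼 n f) ⟨
    1ℚ - 𝔼 n f                      ∎
    where
    open ≡-Reasoning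
    neg-as-scale : ∀ x → 1ℚ - x ≡ 1ℚ + - 1ℚ * x
    neg-as-scale = solve 1 (λ x → con 1ℚ :- x := con 1ℚ :+ con (- 1ℚ) :* x) refl

  𝔼-sum : ∀ n {k} (f : Fin k → Labelling n → ℚ) → 𝔼 n (λ y → sum (λ i → f i y)) ≡ sum (λ i → 𝔼 n (f i))
  𝔼-sum n {zero}  f = 𝔼-const n 0ℚ
  𝔼-sum n {suc k} f = trans (𝔼-+ n (f zero) (λ y → sum (λ i → f (suc i) y))) (cong (_+_ (𝔼 n (f zero))) (𝔼-sum n (f ∘ suc)))

  𝔼-mono-≤ : ∀ n {f g} → (∀ y → f y ≤ g y) → 𝔼 n f ≤ 𝔼 n g
  𝔼-mono-≤ zero    f≤g = f≤g _
  𝔼-mono-≤ (suc n) f≤g = mean-mono-≤ (λ a → 𝔼-mono-≤ n (λ t → f≤g (a ∷ t)))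

  ∃-≤-𝔼 : ∀ n f → ∃[ y ] f y ≤ 𝔼 n f
  ∃-≤-𝔼 zero    f = no-labels , ℚP.≤-refl
  ∃-≤-𝔼 (suc n) f = (a ∷ t) , ℚP.≤-trans t≤ a≤
    where
    fₐ : Fin M → Labelling n → ℚ
    fₐ a t = f (a ∷ t)
    a = proj₁ (∃-≤-mean (λ a → 𝔼 n (fₐ a)))
    a≤ : 𝔼 n (fₐ a) ≤ 𝔼 (suc n) f
    a≤ = proj₂ (∃-≤-mean (λ a → 𝔼 n (fₐ a)))
    t = proj₁ (∃-≤-𝔼 n (fₐ a))
    t≤ : f (a ∷ t) ≤ 𝔼 n (fₐ a)
    t≤ = proj₂ (∃-≤-𝔼 n (fₐ a))

  𝔼-∏∈-coordinates : ∀ n (A : Subset n) φ → 𝔼 n (λ y → ∏∈ A (φ ∘ y)) ≡ mean φ ^ S.∣ A ∣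
  𝔼-∏∈-coordinates zero    V.[]            φ = refl
  𝔼-∏∈-coordinates (suc n) (inside V.∷ A)  φ = begin
    mean (λ a → 𝔼 n (λ t → φ a * ∏∈ A (φ ∘ t)))  ≡⟨ mean-cong (λ a → 𝔼-scale n (φ a) (λ t → ∏∈ A (φ ∘ t))) ⟩
    mean (λ a → φ a * 𝔼 n (λ t → ∏∈ A (φ ∘ t)))  ≡⟨ mean-cong (λ a → cong (_*_ (φ a)) (𝔼-∏∈-coordinates n A φ)) ⟩
    mean (λ a → φ a * mean φ ^ S.∣ A ∣)          ≡⟨ mean-cong (λ a → ℚP.*-comm (φ a) (mean φ ^ S.∣ A ∣)) ⟩
    mean (λ a → mean φ ^ S.∣ A ∣ * φ a)          ≡⟨ mean-scale (mean φ ^ S.∣ A ∣) φ ⟩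
    mean φ ^ S.∣ A ∣ * mean φ                    ≡⟨ ℚP.*-comm _ (mean φ) ⟩
    mean φ ^ suc S.∣ A ∣                         ∎
    where open ≡-Reasoning
  𝔼-∏∈-coordinates (suc n) (outside V.∷ A) φ =
    trans (mean-cong (λ _ → 𝔼-∏∈-coordinates n A φ)) (mean-const (mean φ ^ S.∣ A ∣))

  DependsOn : ∀ {n} → Subset n → (Labelling n → ℚ) → Set
  DependsOn A f = ∀ y y′ → (∀ {i} → i ∈ A → y i ≡ y′ i) → f y ≡ f y′

  DependsOn-⊆ : ∀ {n} {A B : Subset n} {f} → A ⊆ B → DependsOn A f → DependsOn B f
  DependsOn-⊆ A⊆B dep y y′ agree = dep y y′ (agree ∘ A⊆B)

  DependsOn-tail : ∀ {n} {b} {A : Subset n} {f} → DependsOn (b V.∷ A) f → ∀ a → DependsOn A (λ t → f (a ∷ t))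
  DependsOn-tail dep a t t′ agree = dep (a ∷ t) (a ∷ t′) λ { V.here → refl ; (V.there i∈A) → agree i∈A }

  DependsOn-head : ∀ {n} {A : Subset n} {f} → DependsOn (outside V.∷ A) f → ∀ a b t → f (a ∷ t) ≡ f (b ∷ t)
  DependsOn-head dep a b t = dep (a ∷ t) (b ∷ t) λ { (V.there _) → refl }

  ∏∈-DependsOn : ∀ {n k} {A : Subset n} (I : Subset k) {f : Fin k → Labelling n → ℚ} →
                 (∀ {j} → j ∈ I → DependsOn A (f j)) → DependsOn A (λ y → ∏∈ I (λ j → f j y))
  ∏∈-DependsOn I dep y y′ agree = ∏∈-cong I (λ j∈I → dep j∈I y y′ agree)

  private
    𝔼-*-head-free : ∀ n {f g} → (∀ a b t → f (a ∷ t) ≡ f (b ∷ t)) →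
      (∀ a → 𝔼 n (λ t → f (a ∷ t) * g (a ∷ t)) ≡ 𝔼 n (λ t → f (a ∷ t)) * 𝔼 n (λ t → g (a ∷ t))) →
      𝔼 (suc n) (λ y → f y * g y) ≡ 𝔼 (suc n) f * 𝔼 (suc n) g
    𝔼-*-head-free n {f} {g} free split = begin
      mean (λ a → 𝔼 n (λ t → f (a ∷ t) * g (a ∷ t)))              ≡⟨ mean-cong split ⟩
      mean (λ a → 𝔼 n (λ t → f (a ∷ t)) * 𝔼 n (λ t → g (a ∷ t)))  ≡⟨ mean-cong (λ a → cong (_* 𝔼 n (λ t → g (a ∷ t))) (f-free a)) ⟩
      mean (λ a → F₀ * 𝔼 n (λ t → g (a ∷ t)))                     ≡⟨ mean-scale F₀ (λ a → 𝔼 n (λ t → g (a ∷ t))) ⟩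
      F₀ * 𝔼 (suc n) g                                            ≡⟨ cong (_* 𝔼 (suc n) g) (trans (mean-cong f-free) (mean-const F₀)) ⟨
      𝔼 (suc n) f * 𝔼 (suc n) g                                   ∎
      where
      open ≡-Reasoning
      F₀ = 𝔼 n (λ t → f (zero ∷ t))
      f-free : ∀ a → 𝔼 n (λ t → f (a ∷ t)) ≡ F₀
      f-free a = 𝔼-cong n (free a zero)

  𝔼-*-independent : ∀ n (A B : Subset n) f g → DependsOn A f → DependsOn B g → Disjoint A B →
                    𝔼 n (λ y → f y * g y) ≡ 𝔼 n f * 𝔼 n g
  𝔼-*-independent zero V.[] V.[] f g _ _ _ = refl
  𝔼-*-independent (suc n) (inside V.∷ A) (inside V.∷ B) f g _ _ A∩B=∅ = ⊥-elim (A∩B=∅ V.here V.here)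
  𝔼-*-independent (suc n) (outside V.∷ A) (b V.∷ B) f g dep-f dep-g A∩B=∅ =
    𝔼-*-head-free n {f} {g} (DependsOn-head dep-f) λ a →
      𝔼-*-independent n A B (λ t → f (a ∷ t)) (λ t → g (a ∷ t))
        (DependsOn-tail dep-f a) (DependsOn-tail dep-g a) (λ i∈A i∈B → A∩B=∅ (V.there i∈A) (V.there i∈B))
  𝔼-*-independent (suc n) (inside V.∷ A) (outside V.∷ B) f g dep-f dep-g A∩B=∅ = begin
    𝔼 (suc n) (λ y → f y * g y)  ≡⟨ 𝔼-cong (suc n) (λ y → ℚP.*-comm (f y) (g y)) ⟩
    𝔼 (suc n) (λ y → g y * f y)  ≡⟨ 𝔼-*-head-free n {g} {f} (DependsOn-head dep-g) split ⟩
    𝔼 (suc n) g * 𝔼 (suc n) f    ≡⟨ ℚP.*-comm (𝔼 (suc n) g) (𝔼 (suc n) f) ⟩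
    𝔼 (suc n) f * 𝔼 (suc n) g    ∎
    where
    open ≡-Reasoning
    split = λ a → 𝔼-*-independent n B A (λ t → g (a ∷ t)) (λ t → f (a ∷ t))
      (DependsOn-tail dep-g a) (DependsOn-tail dep-f a) (λ i∈B i∈A → A∩B=∅ (V.there i∈A) (V.there i∈B))

  𝔼-∏∈-independent : ∀ n {k} (I : Subset k) (B : Fin k → Subset n) (f : Fin k → Labelling n → ℚ) →
    (∀ {j} → j ∈ I → DependsOn (B j) (f j)) → PairwiseDisjointOn I B →
    𝔼 n (λ y → ∏∈ I (λ j → f j y)) ≡ ∏∈ I (λ j → 𝔼 n (f j))
  𝔼-∏∈-independent n V.[] B f dep disjoint = 𝔼-const n 1ℚ
  𝔼-∏∈-independent n (outside V.∷ I) B f dep disjoint =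
    𝔼-∏∈-independent n I (B ∘ suc) (f ∘ suc) (dep ∘ V.there) (PairwiseDisjointOn-tail disjoint)
  𝔼-∏∈-independent n (inside V.∷ I) B f dep disjoint = trans
    (𝔼-*-independent n (B zero) (∁ (B zero)) (f zero) (λ y → ∏∈ I (λ j → f (suc j) y)) (dep V.here) rest-dep SP.x∈p⇒x∉∁p)
    (cong (_*_ (𝔼 n (f zero))) (𝔼-∏∈-independent n I (B ∘ suc) (f ∘ suc) (dep ∘ V.there) (PairwiseDisjointOn-tail disjoint)))
    where
    B-outside-B₀ : ∀ {j} → j ∈ I → B (suc j) ⊆ ∁ (B zero)
    B-outside-B₀ j∈I i∈Bj = SP.x∉p⇒x∈∁p (λ i∈B₀ → disjoint V.here (V.there j∈I) (λ ()) i∈B₀ i∈Bj)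
    rest-dep = ∏∈-DependsOn I (λ j∈I → DependsOn-⊆ (B-outside-B₀ j∈I) (dep (V.there j∈I)))

  𝔼-condition : ∀ n (v : Fin n) (h : Fin M → Labelling n → ℚ) → (∀ m → DependsOn (∁ ⁅ v ⁆) (h m)) →
                𝔼 n (λ y → h (y v) y) ≡ mean (λ m → 𝔼 n (h m))
  𝔼-condition (suc n) zero h dep = sym (mean-cong λ m →
    trans (mean-cong (λ a → 𝔼-cong n (λ t → DependsOn-head (dep m) a m t))) (mean-const (𝔼 n (λ t → h m (m ∷ t)))))
  𝔼-condition (suc n) (suc v) h dep = begin
    mean (λ a → 𝔼 n (λ t → h (t v) (a ∷ t)))          ≡⟨ mean-cong (λ a → 𝔼-condition n v _ (λ m → DependsOn-tail (dep m) a)) ⟩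
    mean (λ a → mean (λ m → 𝔼 n (λ t → h m (a ∷ t)))) ≡⟨ mean-comm (λ a m → 𝔼 n (λ t → h m (a ∷ t))) ⟩
    mean (λ m → 𝔼 (suc n) (h m))                     ∎
    where open ≡-Reasoning

-- Zero forcing along an ordering of the vertices

module _ {n : ℕ} (G : Graph n) where
  open Graph G

  adjacent⇒≢ : ∀ {u v} → v ∈ N u → u ≢ v
  adjacent⇒≢ {u} v∈Nu refl = loopless u v∈Nu

  block : Fin n → Fin n → Subset n
  block v w = (N w S.- v) ∪ ⁅ w ⁆

  w∈block : ∀ {v} w → w ∈ block v w
  w∈block {v} w = SP.q⊆p∪q (N w S.- v) ⁅ w ⁆ (SP.x∈⁅x⁆ w)

  ∈-block : ∀ {v w x} → x ∈ N w → x ≢ v → x ∈ block v w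
  ∈-block {v} {w} x∈Nw x≢v = SP.p⊆p∪q ⁅ w ⁆ (SP.x∈p∧x≢y⇒x∈p-y x∈Nw x≢v)

  block⁻ : ∀ {v w x} → x ∈ block v w → (x ∈ N w × x ≢ v) ⊎ x ≡ w
  block⁻ {v} {w} x∈B with SP.x∈p∪q⁻ (N w S.- v) ⁅ w ⁆ x∈B
  ... | inj₁ x∈Nw-v = inj₁ (SP.p─q⊆p (N w) ⁅ v ⁆ x∈Nw-v , x∈p-y⇒x≢y (N w) x∈Nw-v)
  ... | inj₂ x∈⁅w⁆  = inj₂ (SP.x∈⁅y⁆⇒x≡y w x∈⁅w⁆)

  v∉block : ∀ {v w} → w ∈ N v → v ∉ block v w
  v∉block w∈Nv v∈B with block⁻ v∈B
  ... | inj₁ (_ , v≢v) = v≢v refl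
  ... | inj₂ refl      = adjacent⇒≢ w∈Nv refl

  ∣block∣ : ∀ {r} → Regular G r → ∀ {v w} → w ∈ N v → S.∣ block v w ∣ ≡ r
  ∣block∣ {r} regular {v} {w} w∈Nv = begin
    S.∣ (N w S.- v) ∪ ⁅ w ⁆ ∣  ≡⟨ ∣p∪⁅x⁆∣≡1+∣p∣ (N w S.- v) (loopless w ∘ SP.p─q⊆p (N w) ⁅ v ⁆) ⟩
    suc S.∣ N w S.- v ∣        ≡⟨ x∈p⇒1+∣p-x∣≡∣p∣ (N w) (symmetric v w w∈Nv) ⟩
    S.∣ N w ∣                  ≡⟨ regular w ⟩
    r                          ∎
    where open ≡-Reasoning

  module _ (girth≥5 : GirthAtLeast G 5) where

    no-triangle : ∀ {a b c} → b ∈ N a → c ∈ N b → a ∈ N c → ⊥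
    no-triangle {a} {b} {c} ab bc ca with girth≥5 record
      { start  = a
      ; rest   = b L.∷ c L.∷ L.[]
      ; long   = s≤s (s≤s (s≤s z≤n))
      ; unique = (adjacent⇒≢ ab All.∷ (adjacent⇒≢ ca ∘ sym) All.∷ All.[]) AP.∷ (adjacent⇒≢ bc All.∷ All.[]) AP.∷ All.[] AP.∷ AP.[]
      ; closed = ab Lk.∷ bc Lk.∷ ca Lk.∷ Lk.[-]
      }
    ... | s≤s (s≤s (s≤s ()))

    no-square : ∀ {a b c d} → b ∈ N a → c ∈ N b → d ∈ N c → a ∈ N d → a ≢ c → b ≢ d → ⊥
    no-square {a} {b} {c} {d} ab bc cd da a≢c b≢d with girth≥5 record
      { start  = a
      ; rest   = b L.∷ c L.∷ d L.∷ L.[]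
      ; long   = s≤s (s≤s (s≤s z≤n))
      ; unique = (adjacent⇒≢ ab All.∷ a≢c All.∷ (adjacent⇒≢ da ∘ sym) All.∷ All.[])
                 AP.∷ (adjacent⇒≢ bc All.∷ b≢d All.∷ All.[]) AP.∷ (adjacent⇒≢ cd All.∷ All.[]) AP.∷ All.[] AP.∷ AP.[]
      ; closed = ab Lk.∷ bc Lk.∷ cd Lk.∷ da Lk.∷ Lk.[-]
      }
    ... | s≤s (s≤s (s≤s (s≤s ())))

    blocks-disjoint : ∀ v → PairwiseDisjointOn (N v) (block v)
    blocks-disjoint v {w} {w′} vw vw′ w≢w′ x∈B x∈B′ with block⁻ x∈B | block⁻ x∈B′
    ... | inj₂ refl          | inj₂ refl        = w≢w′ refl
    ... | inj₂ refl          | inj₁ (w′x , _)   = no-triangle vw (symmetric w′ _ w′x) (symmetric v w′ vw′)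
    ... | inj₁ (wx , _)      | inj₂ refl        = no-triangle vw wx (symmetric v _ vw′)
    ... | inj₁ (wx , x≢v)    | inj₁ (w′x , _)   =
      no-square vw wx (symmetric w′ _ w′x) (symmetric v w′ vw′) (x≢v ∘ sym) w≢w′

module _ {n : ℕ} (G : Graph n) (key : Fin n → ℕ) where
  open Graph G

  Forceable : Fin n → Set
  Forceable v = ∃[ w ] (w ∈ N v × (∀ x → x ∈ block G v w → key x ℕ.< key v))

  forceable? : ∀ v → Dec (Forceable v)
  forceable? v = FP.any? λ w → (w SP.∈? N v) ×-dec FP.all? (λ x → (x SP.∈? block G v w) →-dec (key x ℕ.<? key v))

  unforceable : Subset n
  unforceable = tabulate (λ v → not (does (forceable? v)))

  lookup-unforceable : ∀ v → lookup unforceable v ≡ not (does (forceable? v))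
  lookup-unforceable = VP.lookup∘tabulate _

  ∉unforceable⇒Forceable : ∀ {v} → v ∉ unforceable → Forceable v
  ∉unforceable⇒Forceable {v} v∉Z with forceable? v in eq
  ... | yes forceable = forceable
  ... | no  _         = ⊥-elim (v∉Z (VP.lookup⇒[]= v unforceable (trans (lookup-unforceable v) (cong (not ∘ does) eq))))

  record ForcingStep (S : Subset n) : Set where
    field
      forcer forced : Fin n
      forcer∈S      : forcer ∈ S
      forced∉S      : forced ∉ S
      adjacent      : Adj G forcer forced
      unique        : ∀ x → Adj G forcer x → x ∉ S → x ≡ forced

  -- A missing vertex of the witnessing block is earlier than v, so recurse on it.
  forcingStep : ∀ {S} → unforceable ⊆ S → ∀ v → Acc ℕ._<_ (key v) → v ∉ S → ForcingStep S
  forcingStep {S} Z⊆S v (acc earlier) v∉S with ∉unforceable⇒Forceable (v∉S ∘ Z⊆S)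
  ... | w , w∈Nv , block<v with FP.any? (λ x → (x SP.∈? block G v w) ×-dec ¬? (x SP.∈? S))
  ...   | yes (x , x∈B , x∉S) = forcingStep Z⊆S x (earlier (block<v x x∈B)) x∉S
  ...   | no  none = record
    { forcer   = w
    ; forced   = v
    ; forcer∈S = block⊆S (w∈block G w)
    ; forced∉S = v∉S
    ; adjacent = symmetric v w w∈Nv
    ; unique   = λ x x∈Nw x∉S → decidable-stable (x FP.≟ v) (λ x≢v → x∉S (block⊆S (∈-block G x∈Nw x≢v)))
    }
    where
    block⊆S : ∀ {x} → x ∈ block G v w → x ∈ S
    block⊆S {x} x∈B = decidable-stable (x SP.∈? S) (λ x∉S → none (x , x∈B , x∉S))

  forcing-from : ∀ fuel S → unforceable ⊆ S → n ℕ.≤ fuel ℕ.+ S.∣ S ∣ → Forcing G S S.⊤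
  forcing-from fuel S Z⊆S bound with FP.any? (λ v → ¬? (v SP.∈? S))
  ... | no none = subst (Forcing G S) (SP.⊆-antisym SP.⊆⊤ ⊤⊆S) done
    where
    ⊤⊆S : S.⊤ ⊆ S
    ⊤⊆S {x} _ = decidable-stable (x SP.∈? S) (λ x∉S → none (x , x∉S))
  ... | yes (v , v∉S) with fuel
  ...   | zero = ⊥-elim (ℕP.<-irrefl refl (begin-strict
    n                        ≤⟨ bound ⟩
    S.∣ S ∣                  <⟨ ℕP.≤-reflexive (sym (∣p∪⁅x⁆∣≡1+∣p∣ S v∉S)) ⟩
    S.∣ S ∪ ⁅ v ⁆ ∣          ≤⟨ SP.∣p∣≤n (S ∪ ⁅ v ⁆) ⟩
    n                        ∎))
    where open ℕP.≤-Reasoning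
  ...   | suc fuel′ = step forcer forced forcer∈S forced∉S adjacent unique
                        (forcing-from fuel′ (S ∪ ⁅ forced ⁆) (SP.p⊆p∪q ⁅ forced ⁆ ∘ Z⊆S) bound′)
    where
    open ForcingStep (forcingStep Z⊆S v (ℕI.<-wellFounded (key v)) v∉S)
    bound′ : n ℕ.≤ fuel′ ℕ.+ S.∣ S ∪ ⁅ forced ⁆ ∣
    bound′ = ℕP.≤-trans bound (ℕP.≤-reflexive (trans (sym (ℕP.+-suc fuel′ S.∣ S ∣))
                                                      (cong (fuel′ ℕ.+_) (sym (∣p∪⁅x⁆∣≡1+∣p∣ S forced∉S)))))

  unforceable-isZeroForcingSet : IsZeroForcingSet G unforceable
  unforceable-isZeroForcingSet = forcing-from n unforceable (λ x∈Z → x∈Z) (ℕP.m≤m+n n S.∣ unforceable ∣)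

-- The expected number of unforceable vertices

meanSurvival : ℕ → ℕ → ℚ
meanSurvival r M′ = mean (λ m → (1ℚ - gridPoint m ^ r) ^ r)
  where open Uniform M′

module _ {n : ℕ} (G : Graph n) {r : ℕ} (regular : Regular G r) (girth≥5 : GirthAtLeast G 5) (M′ : ℕ) where
  open Graph G
  open Uniform M′

  key : Labelling n → Fin n → ℕ
  key y x = toℕ (y x) ℕ.* n ℕ.+ toℕ x

  key-mono : ∀ y {x v} → toℕ (y x) ℕ.< toℕ (y v) → key y x ℕ.< key y v
  key-mono y {x} {v} lt = begin-strict
    toℕ (y x) ℕ.* n ℕ.+ toℕ x    <⟨ ℕP.+-monoʳ-< (toℕ (y x) ℕ.* n) (FP.toℕ<n x) ⟩
    toℕ (y x) ℕ.* n ℕ.+ n        ≡⟨ ℕP.+-comm (toℕ (y x) ℕ.* n) n ⟩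
    suc (toℕ (y x)) ℕ.* n        ≤⟨ ℕP.*-monoˡ-≤ n lt ⟩
    toℕ (y v) ℕ.* n              ≤⟨ ℕP.m≤m+n (toℕ (y v) ℕ.* n) (toℕ v) ⟩
    toℕ (y v) ℕ.* n ℕ.+ toℕ v    ∎
    where open ℕP.≤-Reasoning

  below : Fin M → Fin M → ℚ
  below m a = χ (toℕ a ℕ.<ᵇ toℕ m)

  mean-below : ∀ m → mean (below m) ≡ gridPoint m
  mean-below m = cong (_*_ (1/suc M′)) (sum-χ-<ᵇ M (toℕ m) (ℕP.<⇒≤ (FP.toℕ<n m)))

  survival : Fin n → Fin M → Labelling n → ℚ
  survival v m y = ∏∈ (N v) (λ w → 1ℚ - ∏∈ (block G v w) (below m ∘ y))

  survival-InUnitInterval : ∀ v m y → InUnitInterval (survival v m y)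
  survival-InUnitInterval v m y = ∏∈-InUnitInterval (N v) λ w →
    1-InUnitInterval (∏∈-InUnitInterval (block G v w) (λ x → χ-InUnitInterval (toℕ (y x) ℕ.<ᵇ toℕ m)))

  blockFactor-DependsOn : ∀ v w m → DependsOn (block G v w) (λ y → 1ℚ - ∏∈ (block G v w) (below m ∘ y))
  blockFactor-DependsOn v w m y y′ agree = cong (_-_ 1ℚ) (∏∈-cong (block G v w) (cong (below m) ∘ agree))

  block⊆∁⁅v⁆ : ∀ {v w} → w ∈ N v → block G v w ⊆ ∁ ⁅ v ⁆
  block⊆∁⁅v⁆ {v} w∈Nv x∈B = SP.x∉p⇒x∈∁p λ x∈⁅v⁆ →
    v∉block G w∈Nv (subst (_∈ block G v _) (SP.x∈⁅y⁆⇒x≡y v x∈⁅v⁆) x∈B)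

  survival-DependsOn : ∀ v m → DependsOn (∁ ⁅ v ⁆) (survival v m)
  survival-DependsOn v m = ∏∈-DependsOn (N v) λ {w} w∈Nv →
    DependsOn-⊆ (block⊆∁⁅v⁆ w∈Nv) (blockFactor-DependsOn v w m)

  𝔼-survival : ∀ v m → 𝔼 n (survival v m) ≡ (1ℚ - gridPoint m ^ r) ^ r
  𝔼-survival v m = begin
    𝔼 n (survival v m)
      ≡⟨ 𝔼-∏∈-independent n (N v) (block G v) (λ w y → 1ℚ - ∏∈ (block G v w) (below m ∘ y))
           (λ {w} _ → blockFactor-DependsOn v w m) (blocks-disjoint G girth≥5 v) ⟩
    ∏∈ (N v) (λ w → 𝔼 n (λ y → 1ℚ - ∏∈ (block G v w) (below m ∘ y)))
      ≡⟨ ∏∈-cong (N v) 𝔼-blockFactor ⟩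
    ∏∈ (N v) (λ _ → 1ℚ - gridPoint m ^ r)
      ≡⟨ ∏∈-const (N v) (1ℚ - gridPoint m ^ r) ⟩
    (1ℚ - gridPoint m ^ r) ^ S.∣ N v ∣
      ≡⟨ cong ((1ℚ - gridPoint m ^ r) ^_) (regular v) ⟩
    (1ℚ - gridPoint m ^ r) ^ r ∎
    where
    open ≡-Reasoning
    𝔼-blockFactor : ∀ {w} → w ∈ N v → 𝔼 n (λ y → 1ℚ - ∏∈ (block G v w) (below m ∘ y)) ≡ 1ℚ - gridPoint m ^ r
    𝔼-blockFactor {w} w∈Nv = begin
      𝔼 n (λ y → 1ℚ - ∏∈ (block G v w) (below m ∘ y))  ≡⟨ 𝔼-1- n (λ y → ∏∈ (block G v w) (below m ∘ y)) ⟩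
      1ℚ - 𝔼 n (λ y → ∏∈ (block G v w) (below m ∘ y))  ≡⟨ cong (_-_ 1ℚ) (𝔼-∏∈-coordinates n (block G v w) (below m)) ⟩
      1ℚ - mean (below m) ^ S.∣ block G v w ∣           ≡⟨ cong₂ (λ p k → 1ℚ - p ^ k) (mean-below m) (∣block∣ G regular w∈Nv) ⟩
      1ℚ - gridPoint m ^ r                              ∎

  χ-unforceable≤survival : ∀ y v → χ (lookup (unforceable G (key y)) v) ≤ survival v (y v) y
  χ-unforceable≤survival y v =
    subst (_≤ survival v (y v) y) (cong χ (sym (lookup-unforceable G (key y) v))) (by-cases (forceable? G (key y) v))
    where
    factor≡1 : ¬ Forceable G (key y) v → ∀ {w} → w ∈ N v → 1ℚ - ∏∈ (block G v w) (below (y v) ∘ y) ≡ 1ℚ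
    factor≡1 unforced {w} w∈Nv with ∏∈-χ (block G v w) (λ x → toℕ (y x) ℕ.<ᵇ toℕ (y v))
    ... | inj₁ ≡0    = cong (_-_ 1ℚ) ≡0
    ... | inj₂ below = ⊥-elim (unforced (w , w∈Nv , λ x x∈B →
                         key-mono y (ℕP.<ᵇ⇒< _ _ (subst T (sym (below x∈B)) tt))))
    by-cases : (d : Dec (Forceable G (key y) v)) → χ (not (does d)) ≤ survival v (y v) y
    by-cases (yes _)        = proj₁ (survival-InUnitInterval v (y v) y)
    by-cases (no  unforced) = ℚP.≤-reflexive (sym (∏∈-≡1 (N v) (factor≡1 unforced)))

  𝔼-survival-at-own-label : ∀ v → 𝔼 n (λ y → survival v (y v) y) ≡ meanSurvival r M′
  𝔼-survival-at-own-label v = trans (𝔼-condition n v (survival v) (survival-DependsOn v)) (mean-cong (𝔼-survival v))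

  𝔼-∣unforceable∣≤ : 𝔼 n (λ y → toℚ S.∣ unforceable G (key y) ∣) ≤ toℚ n * meanSurvival r M′
  𝔼-∣unforceable∣≤ = begin
    𝔼 n (λ y → toℚ S.∣ unforceable G (key y) ∣)              ≡⟨ 𝔼-cong n (λ y → toℚ-∣p∣ (unforceable G (key y))) ⟩
    𝔼 n (λ y → sum (λ v → indicator v y))                    ≡⟨ 𝔼-sum n indicator ⟩
    sum (λ v → 𝔼 n (indicator v))                            ≤⟨ sum-mono-≤ (λ v → 𝔼-mono-≤ n (λ y → χ-unforceable≤survival y v)) ⟩
    sum (λ v → 𝔼 n (λ y → survival v (y v) y))               ≡⟨ sum-cong-≗ 𝔼-survival-at-own-label ⟩
    sum {n} (λ _ → meanSurvival r M′)                        ≡⟨ sum-const n (meanSurvival r M′) ⟩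
    toℚ n * meanSurvival r M′                                ∎
    where
    open ℚP.≤-Reasoning
    indicator : Fin n → Labelling n → ℚ
    indicator v y = χ (lookup (unforceable G (key y)) v)

  ∃-small-zeroForcingSet : ∃[ Z ] (IsZeroForcingSet G Z × toℚ S.∣ Z ∣ ≤ toℚ n * meanSurvival r M′)
  ∃-small-zeroForcingSet =
    unforceable G (key y) , unforceable-isZeroForcingSet G (key y) , ℚP.≤-trans y-below-mean 𝔼-∣unforceable∣≤
    where
    size : Labelling n → ℚ
    size y = toℚ S.∣ unforceable G (key y) ∣
    y : Labelling n
    y = proj₁ (∃-≤-𝔼 n size)
    y-below-mean : size y ≤ 𝔼 n size
    y-below-mean = proj₂ (∃-≤-𝔼 n size)

-- Riemann sums of xᵃ (1 - xʳ)ᵇ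

powerSum : ℕ → ℕ → ℕ
powerSum a zero    = 0
powerSum a (suc k) = powerSum a k ℕ.+ k ℕ.^ a

binomial-lower : ∀ m a → m ℕ.^ suc a ℕ.+ suc a ℕ.* m ℕ.^ a ℕ.≤ suc m ℕ.^ suc a
binomial-lower m zero    = ℕP.≤-reflexive (base m)
  where
  base : ∀ m → m ℕ.* 1 ℕ.+ 1 ℕ.* 1 ≡ suc m ℕ.* 1
  base = solve-∀
binomial-lower m (suc a) = begin
  m ℕ.^ suc (suc a) ℕ.+ suc (suc a) ℕ.* m ℕ.^ suc a                            ≤⟨ ℕP.m≤m+n _ (suc a ℕ.* m ℕ.^ a) ⟩
  m ℕ.^ suc (suc a) ℕ.+ suc (suc a) ℕ.* m ℕ.^ suc a ℕ.+ suc a ℕ.* m ℕ.^ a     ≡⟨ expand m a (m ℕ.^ a) ⟨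
  suc m ℕ.* (m ℕ.^ suc a ℕ.+ suc a ℕ.* m ℕ.^ a)                                ≤⟨ ℕP.*-monoʳ-≤ (suc m) (binomial-lower m a) ⟩
  suc m ℕ.^ suc (suc a)                                                        ∎
  where
  open ℕP.≤-Reasoning
  expand : ∀ m a p → suc m ℕ.* (m ℕ.* p ℕ.+ suc a ℕ.* p) ≡ m ℕ.* (m ℕ.* p) ℕ.+ suc (suc a) ℕ.* (m ℕ.* p) ℕ.+ suc a ℕ.* p
  expand = solve-∀

binomial-upper : ∀ m a → suc m ℕ.^ suc a ℕ.≤ m ℕ.^ suc a ℕ.+ suc a ℕ.* suc m ℕ.^ a
binomial-upper m zero    = ℕP.≤-reflexive (base m)
  where
  base : ∀ m → suc m ℕ.* 1 ≡ m ℕ.* 1 ℕ.+ 1 ℕ.* 1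
  base = solve-∀
binomial-upper m (suc a) = begin
  suc m ℕ.^ suc (suc a)                                               ≤⟨ ℕP.*-monoʳ-≤ (suc m) (binomial-upper m a) ⟩
  suc m ℕ.* (m ℕ.^ suc a ℕ.+ suc a ℕ.* suc m ℕ.^ a)                   ≡⟨ expand m a (m ℕ.^ a) (suc m ℕ.^ a) ⟩
  m ℕ.^ suc (suc a) ℕ.+ (m ℕ.^ suc a ℕ.+ suc a ℕ.* suc m ℕ.^ suc a)   ≤⟨ ℕP.+-monoʳ-≤ (m ℕ.^ suc (suc a)) (ℕP.+-monoˡ-≤ _ m^[1+a]≤[1+m]^[1+a]) ⟩
  m ℕ.^ suc (suc a) ℕ.+ suc (suc a) ℕ.* suc m ℕ.^ suc a               ∎
  where
  open ℕP.≤-Reasoning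
  m^[1+a]≤[1+m]^[1+a] : m ℕ.^ suc a ℕ.≤ suc m ℕ.^ suc a
  m^[1+a]≤[1+m]^[1+a] = ℕP.^-monoˡ-≤ (suc a) (ℕP.n≤1+n m)
  expand : ∀ m a p s → suc m ℕ.* (m ℕ.* p ℕ.+ suc a ℕ.* s) ≡ m ℕ.* (m ℕ.* p) ℕ.+ (m ℕ.* p ℕ.+ suc a ℕ.* (suc m ℕ.* s))
  expand = solve-∀

*-powerSum≤^ : ∀ a k → suc a ℕ.* powerSum a k ℕ.≤ k ℕ.^ suc a
*-powerSum≤^ a zero    = ℕP.≤-reflexive (ℕP.*-zeroʳ (suc a))
*-powerSum≤^ a (suc k) = begin
  suc a ℕ.* (powerSum a k ℕ.+ k ℕ.^ a)              ≡⟨ ℕP.*-distribˡ-+ (suc a) (powerSum a k) (k ℕ.^ a) ⟩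
  suc a ℕ.* powerSum a k ℕ.+ suc a ℕ.* k ℕ.^ a      ≤⟨ ℕP.+-monoˡ-≤ (suc a ℕ.* k ℕ.^ a) (*-powerSum≤^ a k) ⟩
  k ℕ.^ suc a ℕ.+ suc a ℕ.* k ℕ.^ a                 ≤⟨ binomial-lower k a ⟩
  suc k ℕ.^ suc a                                   ∎
  where open ℕP.≤-Reasoning

^≤*-powerSum : ∀ a k → k ℕ.^ suc a ℕ.≤ suc a ℕ.* powerSum a (suc k)
^≤*-powerSum a zero    = z≤n
^≤*-powerSum a (suc k) = begin
  suc k ℕ.^ suc a                                            ≤⟨ binomial-upper k a ⟩
  k ℕ.^ suc a ℕ.+ suc a ℕ.* suc k ℕ.^ a                      ≤⟨ ℕP.+-monoˡ-≤ (suc a ℕ.* suc k ℕ.^ a) (^≤*-powerSum a k) ⟩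
  suc a ℕ.* powerSum a (suc k) ℕ.+ suc a ℕ.* suc k ℕ.^ a     ≡⟨ ℕP.*-distribˡ-+ (suc a) (powerSum a (suc k)) (suc k ℕ.^ a) ⟨
  suc a ℕ.* powerSum a (suc (suc k))                         ∎
  where open ℕP.≤-Reasoning

-- integral r a b = ∫₀¹ xᵃ (1 - xʳ)ᵇ dx, computed by integrating by parts in b.
integral : ℕ → ℕ → ℕ → ℚ
integral r a zero    = 1/suc a
integral r a (suc b) = integral r a b * toℚ (r ℕ.* suc b) * 1/suc (a ℕ.+ r ℕ.* suc b)

integral-shift : ∀ r a b → integral r (a ℕ.+ r) b * toℚ (suc (a ℕ.+ r ℕ.* suc b)) ≡ integral r a b * toℚ (suc a)
integral-shift r a zero rewrite ℕP.*-identityʳ r = trans (1/suc-inverse (a ℕ.+ r)) (sym (1/suc-inverse a))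
integral-shift r a (suc b) = begin
  Jₛ * x * 1/suc (a ℕ.+ r ℕ.+ r ℕ.* suc b) * toℚ (suc (a ℕ.+ r ℕ.* suc (suc b)))
    ≡⟨ cong (λ d → Jₛ * x * 1/suc d * toℚ (suc (a ℕ.+ r ℕ.* suc (suc b)))) D₁≡D₂ ⟩
  Jₛ * x * 1/suc D₂ * toℚ (suc D₂)        ≡⟨ ℚP.*-assoc (Jₛ * x) (1/suc D₂) (toℚ (suc D₂)) ⟩
  Jₛ * x * (1/suc D₂ * toℚ (suc D₂))      ≡⟨ cong (_*_ (Jₛ * x)) (1/suc-inverse D₂) ⟩
  Jₛ * x * 1ℚ                             ≡⟨ reassoc₁ Jₛ x (1/suc D₁) (toℚ (suc D₁)) (1/suc-inverse D₁) ⟩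
  x * 1/suc D₁ * (Jₛ * toℚ (suc D₁))      ≡⟨ cong (_*_ (x * 1/suc D₁)) (integral-shift r a b) ⟩
  x * 1/suc D₁ * (integral r a b * toℚ (suc a))  ≡⟨ reassoc₂ x (1/suc D₁) (integral r a b) (toℚ (suc a)) ⟩
  integral r a b * x * 1/suc D₁ * toℚ (suc a)    ∎
  where
  open ≡-Reasoning
  Jₛ  = integral r (a ℕ.+ r) b
  x  = toℚ (r ℕ.* suc b)
  D₁ = a ℕ.+ r ℕ.* suc b
  D₂ = a ℕ.+ r ℕ.* suc (suc b)
  D₁≡D₂ : a ℕ.+ r ℕ.+ r ℕ.* suc b ≡ D₂
  D₁≡D₂ = trans (ℕP.+-assoc a r _) (cong (a ℕ.+_) (sym (ℕP.*-suc r (suc b))))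
  reassoc₁ : ∀ j x i s → i * s ≡ 1ℚ → j * x * 1ℚ ≡ x * i * (j * s)
  reassoc₁ j x i s is≡1 = trans (cong (_*_ (j * x)) (sym is≡1))
    (solve 4 (λ j x i s → j :* x :* (i :* s) := x :* i :* (j :* s)) refl j x i s)
  reassoc₂ : ∀ x i k s → x * i * (k * s) ≡ k * x * i * s
  reassoc₂ = solve 4 (λ x i k s → x :* i :* (k :* s) := k :* x :* i :* s) refl

integral-suc : ∀ r a b → integral r a (suc b) ≡ integral r a b - integral r (a ℕ.+ r) b
integral-suc r a b = begin
  J₀ * B * I                      ≡⟨ split J₀ A B I ⟩
  J₀ * ((A + B) * I) - J₀ * A * I  ≡⟨ cong (λ z → J₀ * z - J₀ * A * I) A+B*I≡1 ⟩
  J₀ * 1ℚ - J₀ * A * I             ≡⟨ cong₂ _-_ (ℚP.*-identityʳ J₀) (sym shifted) ⟩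
  J₀ - integral r (a ℕ.+ r) b     ∎
  where
  open ≡-Reasoning
  D = a ℕ.+ r ℕ.* suc b
  J₀ = integral r a b
  A = toℚ (suc a)
  B = toℚ (r ℕ.* suc b)
  I = 1/suc D
  split : ∀ j a b i → j * b * i ≡ j * ((a + b) * i) - j * a * i
  split = solve 4 (λ j a b i → j :* b :* i := j :* ((a :+ b) :* i) :- j :* a :* i) refl
  A+B*I≡1 : (A + B) * I ≡ 1ℚ
  A+B*I≡1 = trans (cong (_* I) (sym (toℚ-+ (suc a) (r ℕ.* suc b)))) (trans (ℚP.*-comm (toℚ (suc D)) I) (1/suc-inverse D))
  shifted : integral r (a ℕ.+ r) b ≡ J₀ * A * I
  shifted = begin
    integral r (a ℕ.+ r) b                          ≡⟨ ℚP.*-identityʳ _ ⟨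
    integral r (a ℕ.+ r) b * 1ℚ                     ≡⟨ cong (_*_ (integral r (a ℕ.+ r) b)) (trans (ℚP.*-comm (toℚ (suc D)) I) (1/suc-inverse D)) ⟨
    integral r (a ℕ.+ r) b * (toℚ (suc D) * I)      ≡⟨ ℚP.*-assoc (integral r (a ℕ.+ r) b) (toℚ (suc D)) I ⟨
    integral r (a ℕ.+ r) b * toℚ (suc D) * I        ≡⟨ cong (_* I) (integral-shift r a b) ⟩
    J₀ * A * I                                       ∎

integral-0≡prodUpTo : ∀ r b → integral r 0 b ≡ prodUpTo r b
integral-0≡prodUpTo r zero    = refl
integral-0≡prodUpTo r (suc b) = trans (ℚP.*-assoc (integral r 0 b) (toℚ d) (1/suc d))
  (cong₂ _*_ (integral-0≡prodUpTo r b) d/[1+d]≡1-1/[1+d])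
  where
  d = r ℕ.* suc b
  d/[1+d]≡1-1/[1+d] : toℚ d * 1/suc d ≡ 1ℚ - 1/suc d
  d/[1+d]≡1-1/[1+d] = begin
    toℚ d * 1/suc d                      ≡⟨ solve 2 (λ x i → x :* i := (con 1ℚ :+ x) :* i :- i) refl (toℚ d) (1/suc d) ⟩
    (1ℚ + toℚ d) * 1/suc d - 1/suc d     ≡⟨ cong (λ z → z * 1/suc d - 1/suc d) (sym (toℚ-+ 1 d)) ⟩
    toℚ (suc d) * 1/suc d - 1/suc d      ≡⟨ cong (_- 1/suc d) (trans (ℚP.*-comm (toℚ (suc d)) (1/suc d)) (1/suc-inverse d)) ⟩
    1ℚ - 1/suc d                         ∎
    where open ≡-Reasoning

sum-toℚ-powerSum : ∀ a k → sum {k} (λ m → toℚ (toℕ m ℕ.^ a)) ≡ toℚ (powerSum a k)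
sum-toℚ-powerSum a zero    = refl
sum-toℚ-powerSum a (suc k) = begin
  sum {suc k} (λ m → toℚ (toℕ m ℕ.^ a))                          ≡⟨ sum-init-last {k} (λ m → toℚ (toℕ m ℕ.^ a)) ⟩
  sum {k} (λ m → toℚ (toℕ (F.inject₁ m) ℕ.^ a)) + toℚ (toℕ (F.fromℕ k) ℕ.^ a)
    ≡⟨ cong₂ _+_ (sum-cong-≗ {k} (λ m → cong (λ i → toℚ (i ℕ.^ a)) (FP.toℕ-inject₁ m)))
                 (cong (λ i → toℚ (i ℕ.^ a)) (FP.toℕ-fromℕ k)) ⟩
  sum {k} (λ m → toℚ (toℕ m ℕ.^ a)) + toℚ (k ℕ.^ a)               ≡⟨ cong (_+ toℚ (k ℕ.^ a)) (sum-toℚ-powerSum a k) ⟩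
  toℚ (powerSum a k) + toℚ (k ℕ.^ a)                             ≡⟨ toℚ-+ (powerSum a k) (k ℕ.^ a) ⟨
  toℚ (powerSum a (suc k))                                       ∎
  where open ≡-Reasoning

1/suc-*-toℚ : ∀ a y → 1/suc a * toℚ (suc a ℕ.* y) ≡ toℚ y
1/suc-*-toℚ a y = begin
  1/suc a * toℚ (suc a ℕ.* y)        ≡⟨ cong (_*_ (1/suc a)) (toℚ-* (suc a) y) ⟩
  1/suc a * (toℚ (suc a) * toℚ y)    ≡⟨ ℚP.*-assoc (1/suc a) (toℚ (suc a)) (toℚ y) ⟨
  1/suc a * toℚ (suc a) * toℚ y      ≡⟨ cong (_* toℚ y) (1/suc-inverse a) ⟩
  1ℚ * toℚ y                         ≡⟨ ℚP.*-identityˡ (toℚ y) ⟩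
  toℚ y                              ∎
  where open ≡-Reasoning

*-cancelʳ-≤-toℚ : ∀ {p q} N → 0 ℕ.< N → p * toℚ N ≤ q * toℚ N → p ≤ q
*-cancelʳ-≤-toℚ {p} {q} (suc c) _ le = subst₂ _≤_ (unscale p) (unscale q) (*-monoʳ-≤-0≤ (1/suc-nonNeg c) le)
  where
  unscale : ∀ z → z * toℚ (suc c) * 1/suc c ≡ z
  unscale z = begin
    z * toℚ (suc c) * 1/suc c      ≡⟨ ℚP.*-assoc z (toℚ (suc c)) (1/suc c) ⟩
    z * (toℚ (suc c) * 1/suc c)    ≡⟨ cong (_*_ z) (trans (ℚP.*-comm (toℚ (suc c)) (1/suc c)) (1/suc-inverse c)) ⟩
    z * 1ℚ                         ≡⟨ ℚP.*-identityʳ z ⟩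
    z                              ∎
    where open ≡-Reasoning

module _ (r M′ : ℕ) where
  open Uniform M′

  riemann : ℕ → ℕ → ℚ
  riemann b a = mean (λ m → gridPoint m ^ a * (1ℚ - gridPoint m ^ r) ^ b)

  riemann-suc : ∀ b a → riemann (suc b) a ≡ riemann b a - riemann b (a ℕ.+ r)
  riemann-suc b a = trans (mean-cong pointwise) (mean-sub (λ m → gridPoint m ^ a * (1ℚ - gridPoint m ^ r) ^ b)
                                                        (λ m → gridPoint m ^ (a ℕ.+ r) * (1ℚ - gridPoint m ^ r) ^ b))
    where
    distribute : ∀ p q s → p * ((1ℚ - q) * s) ≡ p * s - p * q * s
    distribute = solve 3 (λ p q s → p :* ((con 1ℚ :- q) :* s) := p :* s :- p :* q :* s) refl
    pointwise : ∀ m → gridPoint m ^ a * (1ℚ - gridPoint m ^ r) ^ suc b ≡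
                      gridPoint m ^ a * (1ℚ - gridPoint m ^ r) ^ b - gridPoint m ^ (a ℕ.+ r) * (1ℚ - gridPoint m ^ r) ^ b
    pointwise m = trans (distribute (gridPoint m ^ a) (gridPoint m ^ r) ((1ℚ - gridPoint m ^ r) ^ b))
      (cong (λ z → gridPoint m ^ a * (1ℚ - gridPoint m ^ r) ^ b - z * (1ℚ - gridPoint m ^ r) ^ b) (sym (^-homo-* (gridPoint m) a r)))

  1/M^k*M^k≡1 : ∀ k → 1/suc M′ ^ k * toℚ (M ℕ.^ k) ≡ 1ℚ
  1/M^k*M^k≡1 zero    = refl
  1/M^k*M^k≡1 (suc k) = begin
    1/suc M′ * 1/suc M′ ^ k * toℚ (M ℕ.* M ℕ.^ k)           ≡⟨ cong (_*_ (1/suc M′ * 1/suc M′ ^ k)) (toℚ-* M (M ℕ.^ k)) ⟩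
    1/suc M′ * 1/suc M′ ^ k * (toℚ M * toℚ (M ℕ.^ k))       ≡⟨ interchange (1/suc M′) (1/suc M′ ^ k) (toℚ M) (toℚ (M ℕ.^ k)) ⟩
    (1/suc M′ * toℚ M) * (1/suc M′ ^ k * toℚ (M ℕ.^ k))     ≡⟨ cong₂ _*_ (1/suc-inverse M′) (1/M^k*M^k≡1 k) ⟩
    1ℚ * 1ℚ                                                 ≡⟨ ℚP.*-identityˡ 1ℚ ⟩
    1ℚ                                                      ∎
    where
    open ≡-Reasoning
    interchange : ∀ i p m w → i * p * (m * w) ≡ (i * m) * (p * w)
    interchange = solve 4 (λ i p m w → i :* p :* (m :* w) := (i :* m) :* (p :* w)) refl

  riemann-zero : ∀ a → riemann 0 a ≡ 1/suc M′ ^ suc a * toℚ (powerSum a M)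
  riemann-zero a = begin
    1/suc M′ * sum {M} (λ m → gridPoint m ^ a * 1ℚ)              ≡⟨ cong (_*_ (1/suc M′)) (sum-cong-≗ {M} pointwise) ⟩
    1/suc M′ * sum {M} (λ m → 1/suc M′ ^ a * toℚ (toℕ m ℕ.^ a))  ≡⟨ cong (_*_ (1/suc M′)) (sum-scale {M} (1/suc M′ ^ a) powers) ⟩
    1/suc M′ * (1/suc M′ ^ a * sum {M} powers)                   ≡⟨ ℚP.*-assoc (1/suc M′) (1/suc M′ ^ a) (sum {M} powers) ⟨
    1/suc M′ ^ suc a * sum {M} powers                            ≡⟨ cong (_*_ (1/suc M′ ^ suc a)) (sum-toℚ-powerSum a M) ⟩
    1/suc M′ ^ suc a * toℚ (powerSum a M)                        ∎
    where
    open ≡-Reasoning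
    powers : Fin M → ℚ
    powers m = toℚ (toℕ m ℕ.^ a)
    pointwise : ∀ m → gridPoint m ^ a * 1ℚ ≡ 1/suc M′ ^ a * toℚ (toℕ m ℕ.^ a)
    pointwise m = trans (ℚP.*-identityʳ (gridPoint m ^ a)) (trans (^-distrib-* (1/suc M′) (toℚ (toℕ m)) a)
                    (cong (_*_ (1/suc M′ ^ a)) (sym (toℚ-^ (toℕ m) a))))

  error : ℕ → ℚ
  error b = toℚ (2 ℕ.^ b) * 1/suc M′

  error-zero : error 0 ≡ 1/suc M′
  error-zero = ℚP.*-identityˡ (1/suc M′)

  error-suc : ∀ b → error (suc b) ≡ error b + error b
  error-suc b = trans (cong (_* 1/suc M′) (toℚ-* 2 (2 ℕ.^ b))) (double (toℚ (2 ℕ.^ b)) (1/suc M′))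
    where
    double : ∀ x i → toℚ 2 * x * i ≡ x * i + x * i
    double = solve 2 (λ x i → (con 1ℚ :+ con 1ℚ) :* x :* i := x :* i :+ x :* i) refl

  private
    N : ℕ → ℕ
    N a = suc a ℕ.* M ℕ.^ suc a

    0<N : ∀ a → 0 ℕ.< N a
    0<N a = ℕP.<-≤-trans (ℕP.m^n>0 M (suc a)) (ℕP.m≤m+n (M ℕ.^ suc a) (a ℕ.* M ℕ.^ suc a))

    riemann-zero-scaled : ∀ a k → riemann 0 a * toℚ (suc a ℕ.* k) ≡ toℚ (suc a ℕ.* powerSum a M) * (1/suc M′ ^ suc a * toℚ k)
    riemann-zero-scaled a k = begin
      riemann 0 a * toℚ (suc a ℕ.* k)                           ≡⟨ cong₂ _*_ (riemann-zero a) (toℚ-* (suc a) k) ⟩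
      W * toℚ (powerSum a M) * (toℚ (suc a) * toℚ k)            ≡⟨ rearrange W (toℚ (powerSum a M)) (toℚ (suc a)) (toℚ k) ⟩
      toℚ (suc a) * toℚ (powerSum a M) * (W * toℚ k)            ≡⟨ cong (_* (W * toℚ k)) (toℚ-* (suc a) (powerSum a M)) ⟨
      toℚ (suc a ℕ.* powerSum a M) * (W * toℚ k)                ∎
      where
      open ≡-Reasoning
      W = 1/suc M′ ^ suc a
      rearrange : ∀ w s a k → w * s * (a * k) ≡ a * s * (w * k)
      rearrange = solve 4 (λ w s a k → w :* s :* (a :* k) := a :* s :* (w :* k)) refl

  riemann-zero-upper : ∀ a → riemann 0 a ≤ 1/suc a
  riemann-zero-upper a = *-cancelʳ-≤-toℚ (N a) (0<N a) (begin
    riemann 0 a * toℚ (N a)                                   ≡⟨ riemann-zero-scaled a (M ℕ.^ suc a) ⟩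
    toℚ (suc a ℕ.* powerSum a M) * (1/suc M′ ^ suc a * toℚ (M ℕ.^ suc a))
                                                              ≡⟨ cong (_*_ (toℚ (suc a ℕ.* powerSum a M))) (1/M^k*M^k≡1 (suc a)) ⟩
    toℚ (suc a ℕ.* powerSum a M) * 1ℚ                         ≡⟨ ℚP.*-identityʳ _ ⟩
    toℚ (suc a ℕ.* powerSum a M)                              ≤⟨ toℚ-mono-≤ (*-powerSum≤^ a M) ⟩
    toℚ (M ℕ.^ suc a)                                         ≡⟨ 1/suc-*-toℚ a (M ℕ.^ suc a) ⟨
    1/suc a * toℚ (N a)                                       ∎)
    where open ℚP.≤-Reasoning

  riemann-zero-lower : ∀ a → 1/suc a - 1/suc M′ ≤ riemann 0 a
  riemann-zero-lower a = subst (1/suc a - 1/suc M′ ≤_) (cancel (riemann 0 a) (1/suc M′))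
    (sub-mono-≤ (*-cancelʳ-≤-toℚ {1/suc a} {riemann 0 a + 1/suc M′} (N a) (0<N a) (begin
      1/suc a * toℚ (N a)                                     ≡⟨ 1/suc-*-toℚ a (M ℕ.^ suc a) ⟩
      toℚ (M ℕ.^ suc a)                                       ≤⟨ toℚ-mono-≤ (^≤*-powerSum a M) ⟩
      toℚ (suc a ℕ.* powerSum a (suc M))                      ≡⟨ cong toℚ (ℕP.*-distribˡ-+ (suc a) (powerSum a M) (M ℕ.^ a)) ⟩
      toℚ (suc a ℕ.* powerSum a M ℕ.+ suc a ℕ.* M ℕ.^ a)      ≡⟨ toℚ-+ (suc a ℕ.* powerSum a M) (suc a ℕ.* M ℕ.^ a) ⟩
      toℚ (suc a ℕ.* powerSum a M) + toℚ (suc a ℕ.* M ℕ.^ a)  ≡⟨ cong₂ _+_ unit₁ unit₂ ⟨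
      riemann 0 a * toℚ (N a) + 1/suc M′ * toℚ (N a)          ≡⟨ ℚP.*-distribʳ-+ (toℚ (N a)) (riemann 0 a) (1/suc M′) ⟨
      (riemann 0 a + 1/suc M′) * toℚ (N a)                    ∎)) (ℚP.≤-refl {1/suc M′}))
    where
    open ℚP.≤-Reasoning
    cancel : ∀ p q → p + q - q ≡ p
    cancel = solve 2 (λ p q → p :+ q :- q := p) refl
    unit₁ : riemann 0 a * toℚ (N a) ≡ toℚ (suc a ℕ.* powerSum a M)
    unit₁ = trans (riemann-zero-scaled a (M ℕ.^ suc a))
              (trans (cong (_*_ (toℚ (suc a ℕ.* powerSum a M))) (1/M^k*M^k≡1 (suc a))) (ℚP.*-identityʳ _))
    unit₂ : 1/suc M′ * toℚ (N a) ≡ toℚ (suc a ℕ.* M ℕ.^ a)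
    unit₂ = begin-equality
      1/suc M′ * toℚ (suc a ℕ.* (M ℕ.* M ℕ.^ a))       ≡⟨ cong (λ k → 1/suc M′ * toℚ k) (ℕP.*-comm (suc a) (M ℕ.* M ℕ.^ a)) ⟩
      1/suc M′ * toℚ (M ℕ.* M ℕ.^ a ℕ.* suc a)         ≡⟨ cong (λ k → 1/suc M′ * toℚ k) (ℕP.*-assoc M (M ℕ.^ a) (suc a)) ⟩
      1/suc M′ * toℚ (M ℕ.* (M ℕ.^ a ℕ.* suc a))       ≡⟨ 1/suc-*-toℚ M′ (M ℕ.^ a ℕ.* suc a) ⟩
      toℚ (M ℕ.^ a ℕ.* suc a)                          ≡⟨ cong toℚ (ℕP.*-comm (M ℕ.^ a) (suc a)) ⟩
      toℚ (suc a ℕ.* M ℕ.^ a)                          ∎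

  -- riemann and integral obey the same recursion in b, which at most doubles the error.
  riemann≈integral : ∀ b a → integral r a b - error b ≤ riemann b a × riemann b a ≤ integral r a b + error b
  riemann≈integral zero a =
    subst (λ e → 1/suc a - e ≤ riemann 0 a) (sym error-zero) (riemann-zero-lower a) ,
    ℚP.≤-trans (riemann-zero-upper a) (p≤p+q (subst (0ℚ ≤_) (sym error-zero) (1/suc-nonNeg M′)))
  riemann≈integral (suc b) a =
    subst₂ _≤_ lower-eq (sym (riemann-suc b a)) (sub-mono-≤ (proj₁ (riemann≈integral b a)) (proj₂ (riemann≈integral b (a ℕ.+ r)))) ,
    subst₂ _≤_ (sym (riemann-suc b a)) upper-eq (sub-mono-≤ (proj₂ (riemann≈integral b a)) (proj₁ (riemann≈integral b (a ℕ.+ r))))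
    where
    I₀ = integral r a b
    Iₛ = integral r (a ℕ.+ r) b
    lower-eq : (I₀ - error b) - (Iₛ + error b) ≡ integral r a (suc b) - error (suc b)
    lower-eq = trans (solve 3 (λ x y e → (x :- e) :- (y :+ e) := (x :- y) :- (e :+ e)) refl I₀ Iₛ (error b))
                     (sym (cong₂ _-_ (integral-suc r a b) (error-suc b)))
    upper-eq : (I₀ + error b) - (Iₛ - error b) ≡ integral r a (suc b) + error (suc b)
    upper-eq = trans (solve 3 (λ x y e → (x :+ e) :- (y :- e) := (x :- y) :+ (e :+ e)) refl I₀ Iₛ (error b))
                     (sym (cong₂ _+_ (integral-suc r a b) (error-suc b)))

  meanSurvival≤ : meanSurvival r M′ ≤ P r + error r
  meanSurvival≤ = subst₂ _≤_ (mean-cong (λ m → ℚP.*-identityˡ ((1ℚ - gridPoint m ^ r) ^ r)))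
                             (cong (_+ error r) (integral-0≡prodUpTo r r))
                             (proj₂ (riemann≈integral r 0))

-- Refining the grid

∃-1/suc≤ : ∀ d → 0ℚ < d → ∃[ q ] 1/suc q ≤ d
∃-1/suc≤ (mkℚ (+ zero) q _) 0<d with ℚP.drop-*<* 0<d
... | ℤ.+<+ ()
∃-1/suc≤ d@(mkℚ (+ suc p) q _) _ = q , (begin
  1/suc q                ≡⟨ ℚP.*-identityˡ (1/suc q) ⟨
  1ℚ * 1/suc q           ≤⟨ *-monoʳ-≤-0≤ (1/suc-nonNeg q) (toℚ-mono-≤ {1} {suc p} (s≤s z≤n)) ⟩
  toℚ (suc p) * 1/suc q  ≡⟨ /suc≡toℚ*1/suc (suc p) q ⟨
  + suc p / suc q        ≡⟨ ℚP.↥p/↧p≡p d ⟩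
  d                      ∎)
  where open ℚP.≤-Reasoning
∃-1/suc≤ (mkℚ -[1+ p ] q _) 0<d with ℚP.drop-*<* 0<d
... | ()

toℚ*1/suc≤1/suc : ∀ c D E → c ℕ.* suc D ℕ.≤ suc E → toℚ c * 1/suc E ≤ 1/suc D
toℚ*1/suc≤1/suc c D E le = *-cancelʳ-≤-toℚ (suc D ℕ.* suc E) (s≤s z≤n) (begin
  toℚ c * 1/suc E * toℚ (suc D ℕ.* suc E)          ≡⟨ cong (_*_ (toℚ c * 1/suc E)) (toℚ-* (suc D) (suc E)) ⟩
  toℚ c * 1/suc E * (toℚ (suc D) * toℚ (suc E))    ≡⟨ rearrange (toℚ c) (1/suc E) (toℚ (suc D)) (toℚ (suc E)) ⟩
  toℚ c * toℚ (suc D) * (1/suc E * toℚ (suc E))    ≡⟨ cong₂ _*_ (sym (toℚ-* c (suc D))) (1/suc-inverse E) ⟩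
  toℚ (c ℕ.* suc D) * 1ℚ                           ≡⟨ ℚP.*-identityʳ (toℚ (c ℕ.* suc D)) ⟩
  toℚ (c ℕ.* suc D)                                ≤⟨ toℚ-mono-≤ le ⟩
  toℚ (suc E)                                      ≡⟨ 1/suc-*-toℚ D (suc E) ⟨
  1/suc D * toℚ (suc D ℕ.* suc E)                  ∎)
  where
  open ℚP.≤-Reasoning
  rearrange : ∀ c i d e → c * i * (d * e) ≡ c * d * (i * e)
  rearrange = solve 4 (λ c i d e → c :* i :* (d :* e) := c :* d :* (i :* e)) refl

≤-of-≤+c/suc : ∀ {p x} c → (∀ M′ → p ≤ x + toℚ c * 1/suc M′) → p ≤ x
≤-of-≤+c/suc {p} {x} c bound with p ℚP.≤? x
... | yes p≤x = p≤x
... | no  p≰x = ⊥-elim (ℚP.<-irrefl refl p<p)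
  where
  0<p-x : 0ℚ < p - x
  0<p-x = subst (_< p - x) (ℚP.+-inverseʳ x) (ℚP.+-monoˡ-< (- x) (ℚP.≰⇒> p≰x))
  q : ℕ
  q = proj₁ (∃-1/suc≤ (p - x) 0<p-x)
  M′ : ℕ
  M′ = c ℕ.* suc (suc q)
  cancel : ∀ p x → x + (p - x) ≡ p
  cancel = solve 2 (λ p x → x :+ (p :- x) := p) refl
  p<p : p < p
  p<p = begin-strict
    p                       ≤⟨ bound M′ ⟩
    x + toℚ c * 1/suc M′    ≤⟨ ℚP.+-monoʳ-≤ x (toℚ*1/suc≤1/suc c (suc q) M′ (ℕP.n≤1+n M′)) ⟩
    x + 1/suc (suc q)       <⟨ ℚP.+-monoʳ-< x (1/suc-antimono-< (ℕP.n<1+n q)) ⟩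
    x + 1/suc q             ≤⟨ ℚP.+-monoʳ-≤ x (proj₂ (∃-1/suc≤ (p - x) 0<p-x)) ⟩
    x + (p - x)             ≡⟨ cancel p x ⟩
    p                       ∎
    where open ℚP.≤-Reasoning

zeroForcingNumber≤P*n : ∀ {r n} (G : Graph n) → Regular G r → GirthAtLeast G 5 →
                        ∀ {k} → IsZeroForcingNumber G k → toℚ k ≤ P r * toℚ n
zeroForcingNumber≤P*n {r} {n} G regular girth≥5 {k} (_ , minimal) =
  subst (toℚ k ≤_) (ℚP.*-comm (toℚ n) (P r)) (≤-of-≤+c/suc (n ℕ.* 2 ℕ.^ r) bound)
  where
  bound : ∀ M′ → toℚ k ≤ toℚ n * P r + toℚ (n ℕ.* 2 ℕ.^ r) * 1/suc M′
  bound M′ = begin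
    toℚ k                                              ≤⟨ toℚ-mono-≤ (minimal Z Z-forcing) ⟩
    toℚ S.∣ Z ∣                                        ≤⟨ Z-small ⟩
    toℚ n * meanSurvival r M′                          ≤⟨ *-monoˡ-≤-0≤ (toℚ-nonNeg n) (meanSurvival≤ r M′) ⟩
    toℚ n * (P r + toℚ (2 ℕ.^ r) * 1/suc M′)           ≡⟨ distribute (toℚ n) (P r) (toℚ (2 ℕ.^ r)) (1/suc M′) ⟩
    toℚ n * P r + toℚ n * toℚ (2 ℕ.^ r) * 1/suc M′     ≡⟨ cong (λ z → toℚ n * P r + z * 1/suc M′) (toℚ-* n (2 ℕ.^ r)) ⟨
    toℚ n * P r + toℚ (n ℕ.* 2 ℕ.^ r) * 1/suc M′       ∎
    where
    open ℚP.≤-Reasoning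
    small = ∃-small-zeroForcingSet G regular girth≥5 M′
    Z = proj₁ small
    Z-forcing = proj₁ (proj₂ small)
    Z-small = proj₂ (proj₂ small)
    distribute : ∀ n p t i → n * (p + t * i) ≡ n * p + n * t * i
    distribute = solve 4 (λ n p t i → n :* (p :+ t :* i) := n :* p :+ n :* t :* i) refl

-- Comparison of P r with the harmonic numbers

partialSum : (ℕ → ℚ) → ℕ → ℚ
partialSum a zero    = 0ℚ
partialSum a (suc k) = partialSum a k + a k

partialProduct : (ℕ → ℚ) → ℕ → ℚ
partialProduct a zero    = 1ℚ
partialProduct a (suc k) = partialProduct a k * (1ℚ - a k)

module _ {a : ℕ → ℚ} (a∈[0,1] : ∀ i → InUnitInterval (a i)) where

  partialSum-nonNeg : ∀ k → 0ℚ ≤ partialSum a k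
  partialSum-nonNeg zero    = ℚP.≤-refl
  partialSum-nonNeg (suc k) = ℚP.+-mono-≤ {0ℚ} {_} {0ℚ} (partialSum-nonNeg k) (proj₁ (a∈[0,1] k))

  partialProduct-InUnitInterval : ∀ k → InUnitInterval (partialProduct a k)
  partialProduct-InUnitInterval zero    = 0≤1 , ℚP.≤-refl
  partialProduct-InUnitInterval (suc k) = *-InUnitInterval (partialProduct-InUnitInterval k) (1-InUnitInterval (a∈[0,1] k))

  1-partialSum≤partialProduct : ∀ k → 1ℚ - partialSum a k ≤ partialProduct a k
  1-partialSum≤partialProduct zero    = ℚP.≤-refl
  1-partialSum≤partialProduct (suc k) = begin
    1ℚ - (s + a k)          ≡⟨ regroup s (a k) ⟩
    (1ℚ - s) - a k          ≤⟨ sub-mono-≤ (1-partialSum≤partialProduct k) p*a≤a ⟩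
    p - p * a k             ≡⟨ factor p (a k) ⟩
    p * (1ℚ - a k)          ∎
    where
    open ℚP.≤-Reasoning
    s = partialSum a k
    p = partialProduct a k
    p*a≤a : p * a k ≤ a k
    p*a≤a = subst (p * a k ≤_) (ℚP.*-identityˡ (a k)) (*-monoʳ-≤-0≤ (proj₁ (a∈[0,1] k)) (proj₂ (partialProduct-InUnitInterval k)))
    regroup : ∀ s a → 1ℚ - (s + a) ≡ (1ℚ - s) - a
    regroup = solve 2 (λ s a → con 1ℚ :- (s :+ a) := (con 1ℚ :- s) :- a) refl
    factor : ∀ p a → p - p * a ≡ p * (1ℚ - a)
    factor = solve 2 (λ p a → p :- p :* a := p :* (con 1ℚ :- a)) refl

  partialProduct≤1-partialSum+partialSum² : ∀ k → partialProduct a k ≤ 1ℚ - partialSum a k + partialSum a k * partialSum a k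
  partialProduct≤1-partialSum+partialSum² zero    = ℚP.≤-refl
  partialProduct≤1-partialSum+partialSum² (suc k) = begin
    partialProduct a k * (1ℚ - A)           ≤⟨ *-monoʳ-≤-0≤ (proj₁ (1-InUnitInterval (a∈[0,1] k))) (partialProduct≤1-partialSum+partialSum² k) ⟩
    (1ℚ - s + s * s) * (1ℚ - A)             ≤⟨ p≤p+q extra≥0 ⟩
    (1ℚ - s + s * s) * (1ℚ - A) + extra     ≡⟨ expand s A ⟨
    1ℚ - (s + A) + (s + A) * (s + A)        ∎
    where
    open ℚP.≤-Reasoning
    s = partialSum a k
    A = a k
    extra = A * s + A * A + A * s * s
    0≤A = proj₁ (a∈[0,1] k)
    0≤s = partialSum-nonNeg k
    extra≥0 : 0ℚ ≤ extra
    extra≥0 = ℚP.+-mono-≤ {0ℚ} {_} {0ℚ} (ℚP.+-mono-≤ {0ℚ} {_} {0ℚ} (0≤*0≤ 0≤A 0≤s) (0≤*0≤ 0≤A 0≤A))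
                                        (0≤*0≤ (0≤*0≤ 0≤A 0≤s) 0≤s)
    expand : ∀ s a → 1ℚ - (s + a) + (s + a) * (s + a) ≡ (1ℚ - s + s * s) * (1ℚ - a) + (a * s + a * a + a * s * s)
    expand = solve 2 (λ s a → con 1ℚ :- (s :+ a) :+ (s :+ a) :* (s :+ a) :=
                              (con 1ℚ :- s :+ s :* s) :* (con 1ℚ :- a) :+ (a :* s :+ a :* a :+ a :* s :* s)) refl

1/suc-difference : ∀ N → 1/suc N - 1/suc (suc N) ≡ 1/suc N * 1/suc (suc N)
1/suc-difference N = begin
  x - y                      ≡⟨ cong₂ _-_ (sym (trans (cong (_*_ x) (1/suc-inverse (suc N))) (ℚP.*-identityʳ x)))
                                          (sym (trans (cong (_*_ y) (1/suc-inverse N)) (ℚP.*-identityʳ y))) ⟩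
  x * (y * Y) - y * (x * X)  ≡⟨ factor x y X Y ⟩
  x * y * (Y - X)            ≡⟨ cong (_*_ (x * y)) Y-X≡1 ⟩
  x * y * 1ℚ                 ≡⟨ ℚP.*-identityʳ (x * y) ⟩
  x * y                      ∎
  where
  open ≡-Reasoning
  x = 1/suc N
  y = 1/suc (suc N)
  X = toℚ (suc N)
  Y = toℚ (suc (suc N))
  factor : ∀ x y X Y → x * (y * Y) - y * (x * X) ≡ x * y * (Y - X)
  factor = solve 4 (λ x y X Y → x :* (y :* Y) :- y :* (x :* X) := x :* y :* (Y :- X)) refl
  Y-X≡1 : Y - X ≡ 1ℚ
  Y-X≡1 = trans (cong (_- X) (toℚ-+ 1 (suc N))) (solve 1 (λ X → con 1ℚ :+ X :- X := con 1ℚ) refl X)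

H-nonNeg : ∀ k → 0ℚ ≤ H k
H-nonNeg zero    = ℚP.≤-refl
H-nonNeg (suc k) = ℚP.+-mono-≤ {0ℚ} {H k} {0ℚ} (H-nonNeg k) (1/suc-nonNeg k)

1≤H[1+k] : ∀ k → 1ℚ ≤ H (suc k)
1≤H[1+k] zero    = ℚP.≤-refl
1≤H[1+k] (suc k) = ℚP.≤-trans (1≤H[1+k] k) (p≤p+q (1/suc-nonNeg (suc k)))

module _ (r′ : ℕ) where

  defect : ℕ → ℚ
  defect i = 1/suc (suc r′ ℕ.* suc i)

  defect-InUnitInterval : ∀ i → InUnitInterval (defect i)
  defect-InUnitInterval i = 1/suc-nonNeg (suc r′ ℕ.* suc i) , 1/suc≤1 (suc r′ ℕ.* suc i)

  prodUpTo≡partialProduct : ∀ k → prodUpTo (suc r′) k ≡ partialProduct defect k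
  prodUpTo≡partialProduct zero    = refl
  prodUpTo≡partialProduct (suc k) = cong (_* (1ℚ - defect k)) (prodUpTo≡partialProduct k)

  private
    t : ℕ → ℚ
    t i = 1/suc i * 1/suc r′

    N : ℕ → ℕ
    N i = r′ ℕ.+ i ℕ.* suc r′

    t≡ : ∀ i → t i ≡ 1/suc (N i)
    t≡ i = 1/suc-* i r′

    defect≡ : ∀ i → defect i ≡ 1/suc (suc (N i))
    defect≡ i = cong (λ d → 1/suc (suc d)) (reorder i r′)
      where
      reorder : ∀ i r′ → i ℕ.+ r′ ℕ.* suc i ≡ r′ ℕ.+ i ℕ.* suc r′
      reorder = solve-∀

    defect≤t : ∀ i → defect i ≤ t i
    defect≤t i = subst₂ _≤_ (sym (defect≡ i)) (sym (t≡ i)) (1/suc-antimono-≤ (ℕP.n≤1+n (N i)))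

    t-defect≤t/r : ∀ i → t i - defect i ≤ t i * 1/suc r′
    t-defect≤t/r i rewrite t≡ i | defect≡ i = subst (_≤ 1/suc (N i) * 1/suc r′) (sym (1/suc-difference (N i)))
      (*-monoˡ-≤-0≤ (1/suc-nonNeg (N i)) (1/suc-antimono-≤ (ℕP.≤-trans (ℕP.m≤m+n r′ (i ℕ.* suc r′)) (ℕP.n≤1+n (N i)))))

    H/r-suc : ∀ i → H (suc i) * 1/suc r′ ≡ H i * 1/suc r′ + t i
    H/r-suc i = ℚP.*-distribʳ-+ (1/suc r′) (H i) (1/suc i)

  partialSum≤H/r : ∀ k → partialSum defect k ≤ H k * 1/suc r′
  partialSum≤H/r zero    = ℚP.≤-reflexive (sym (ℚP.*-zeroˡ (1/suc r′)))
  partialSum≤H/r (suc k) = subst (partialSum defect (suc k) ≤_) (sym (H/r-suc k)) (ℚP.+-mono-≤ (partialSum≤H/r k) (defect≤t k))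

  H/r-partialSum≤H/r² : ∀ k → H k * 1/suc r′ - partialSum defect k ≤ H k * 1/suc r′ * 1/suc r′
  H/r-partialSum≤H/r² zero    = ℚP.≤-reflexive (solve 1 (λ i → con 0ℚ :* i :- con 0ℚ := con 0ℚ :* i :* i) refl (1/suc r′))
  H/r-partialSum≤H/r² (suc k) = subst₂ _≤_ regroup collect (ℚP.+-mono-≤ (H/r-partialSum≤H/r² k) (t-defect≤t/r k))
    where
    h = H k * 1/suc r′
    s = partialSum defect k
    regroup : (h - s) + (t k - defect k) ≡ H (suc k) * 1/suc r′ - partialSum defect (suc k)
    regroup = trans (solve 4 (λ h s t a → (h :- s) :+ (t :- a) := (h :+ t) :- (s :+ a)) refl h s (t k) (defect k))
                    (cong (_- partialSum defect (suc k)) (sym (H/r-suc k)))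
    collect : h * 1/suc r′ + t k * 1/suc r′ ≡ H (suc k) * 1/suc r′ * 1/suc r′
    collect = trans (sym (ℚP.*-distribʳ-+ (1/suc r′) h (t k))) (cong (_* 1/suc r′) (sym (H/r-suc k)))

1-H/r≤P : ∀ r → .{{_ : ℕ.NonZero r}} → 1ℚ - HoverR r ≤ P r
1-H/r≤P (suc r′) = begin
  1ℚ - HoverR (suc r′)                   ≤⟨ sub-mono-≤ (ℚP.≤-refl {1ℚ}) (partialSum≤H/r r′ (suc r′)) ⟩
  1ℚ - partialSum (defect r′) (suc r′)   ≤⟨ 1-partialSum≤partialProduct (defect-InUnitInterval r′) (suc r′) ⟩
  partialProduct (defect r′) (suc r′)    ≡⟨ prodUpTo≡partialProduct r′ (suc r′) ⟨
  P (suc r′)                             ∎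
  where open ℚP.≤-Reasoning

P≤1-H/r+2[H/r]² : ∀ r → .{{_ : ℕ.NonZero r}} → P r ≤ 1ℚ - HoverR r + (1ℚ + 1ℚ) * (HoverR r * HoverR r)
P≤1-H/r+2[H/r]² (suc r′) = begin
  P (suc r′)                                 ≡⟨ prodUpTo≡partialProduct r′ (suc r′) ⟩
  partialProduct (defect r′) (suc r′)        ≤⟨ partialProduct≤1-partialSum+partialSum² (defect-InUnitInterval r′) (suc r′) ⟩
  1ℚ - s + s * s                             ≡⟨ regroup h s ⟩
  (1ℚ - h) + ((h - s) + s * s)               ≤⟨ ℚP.+-monoʳ-≤ (1ℚ - h) (ℚP.+-mono-≤ h-s≤h² s²≤h²) ⟩
  (1ℚ - h) + (h * h + h * h)                 ≡⟨ cong (_+_ (1ℚ - h)) (double (h * h)) ⟩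
  1ℚ - h + (1ℚ + 1ℚ) * (h * h)               ∎
  where
  open ℚP.≤-Reasoning
  h = HoverR (suc r′)
  s = partialSum (defect r′) (suc r′)
  0≤h : 0ℚ ≤ h
  0≤h = 0≤*0≤ (H-nonNeg (suc r′)) (1/suc-nonNeg r′)
  s≤h : s ≤ h
  s≤h = partialSum≤H/r r′ (suc r′)
  1/r≤h : 1/suc r′ ≤ h
  1/r≤h = subst (_≤ h) (ℚP.*-identityˡ (1/suc r′)) (*-monoʳ-≤-0≤ (1/suc-nonNeg r′) (1≤H[1+k] r′))
  h-s≤h² : h - s ≤ h * h
  h-s≤h² = ℚP.≤-trans (H/r-partialSum≤H/r² r′ (suc r′)) (*-monoˡ-≤-0≤ 0≤h 1/r≤h)
  s²≤h² : s * s ≤ h * h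
  s²≤h² = ℚP.≤-trans (*-monoʳ-≤-0≤ (partialSum-nonNeg (defect-InUnitInterval r′) (suc r′)) s≤h) (*-monoˡ-≤-0≤ 0≤h s≤h)
  regroup : ∀ h s → 1ℚ - s + s * s ≡ (1ℚ - h) + ((h - s) + s * s)
  regroup = solve 2 (λ h s → con 1ℚ :- s :+ s :* s := (con 1ℚ :- h) :+ ((h :- s) :+ s :* s)) refl
  double : ∀ x → x + x ≡ (1ℚ + 1ℚ) * x
  double = solve 1 (λ x → x :+ x := (con 1ℚ :+ con 1ℚ) :* x) refl

∣P-[1-H/r]∣≤2[H/r]² : ∀ r → .{{_ : ℕ.NonZero r}} → ∣ P r - (1ℚ - HoverR r) ∣ ≤ (1ℚ + 1ℚ) * (HoverR r * HoverR r)
∣P-[1-H/r]∣≤2[H/r]² r = begin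
  ∣ P r - (1ℚ - h) ∣      ≡⟨ ℚP.0≤p⇒∣p∣≡p (p≤q⇒0≤q-p (1-H/r≤P r)) ⟩
  P r - (1ℚ - h)          ≤⟨ sub-mono-≤ (P≤1-H/r+2[H/r]² r) (ℚP.≤-refl {1ℚ - h}) ⟩
  1ℚ - h + E - (1ℚ - h)   ≡⟨ cancel (1ℚ - h) E ⟩
  E                       ∎
  where
  open ℚP.≤-Reasoning
  h = HoverR r
  E = (1ℚ + 1ℚ) * (h * h)
  cancel : ∀ x e → x + e - x ≡ e
  cancel = solve 2 (λ x e → x :+ e :- x := e) refl

corollary1 : ((r : ℕ) → .{{_ : ℕ.NonZero r}} → (n : ℕ) → (G : Graph n) →
      Regular G r → GirthAtLeast G 5 → (k : ℕ) → IsZeroForcingNumber G k →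
      toℚ k ≤ P r * toℚ n)
    × Σ ℚ (λ C → (r : ℕ) → .{{_ : ℕ.NonZero r}} →
        ∣ P r - (1ℚ - HoverR r) ∣ ≤ C * (HoverR r * HoverR r))
    × Σ ℚ (λ C → (r : ℕ) → .{{_ : ℕ.NonZero r}} → (n : ℕ) → (G : Graph n) →
        Regular G r → GirthAtLeast G 5 → (k : ℕ) → IsZeroForcingNumber G k →
        toℚ k ≤ (1ℚ - HoverR r) * toℚ n + C * (HoverR r * HoverR r) * toℚ n)
corollary1 =
  (λ r n G regular girth≥5 k Z[G]≡k → zeroForcingNumber≤P*n G regular girth≥5 Z[G]≡k) ,
  (1ℚ + 1ℚ , ∣P-[1-H/r]∣≤2[H/r]²) ,
  (1ℚ + 1ℚ , λ r n G regular girth≥5 k Z[G]≡k → begin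
    toℚ k                                                        ≤⟨ zeroForcingNumber≤P*n G regular girth≥5 Z[G]≡k ⟩
    P r * toℚ n                                                  ≤⟨ *-monoʳ-≤-0≤ (toℚ-nonNeg n) (P≤1-H/r+2[H/r]² r) ⟩
    (1ℚ - HoverR r + (1ℚ + 1ℚ) * (HoverR r * HoverR r)) * toℚ n
      ≡⟨ ℚP.*-distribʳ-+ (toℚ n) (1ℚ - HoverR r) ((1ℚ + 1ℚ) * (HoverR r * HoverR r)) ⟩
    (1ℚ - HoverR r) * toℚ n + (1ℚ + 1ℚ) * (HoverR r * HoverR r) * toℚ n  ∎)
  where open ℚP.≤-Reasoning
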